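{- (Chain Lemma.) Let $\kappa=(\alpha,\mu,\rho,\chi)$ be a configuration reachable from the initial configuration of the DRL transition system, and let $B$ be an internal actor of $\kappa$. If $B$ is not in the root set, then in $\kappa$ there is a chain to every unreleased refob $x: A\to B$. Otherwise, in $\kappa$ there is a chain to some refob $y: C\to B$ where $C$ is an external actor.
   Context: DRL transition system. Actors are identified by addresses; tokens are globally unique identifiers. A refob is a triple $(x,A,B)$ of a token $x$, an owner $A$ and a target $B$, written $x: A\to B$. A fact is one of $\mathrm{Created}(x)$, $\mathrm{Released}(x)$, $\mathrm{CreatedUsing}(x,y)$, $\mathrm{Activated}(x)$, $\mathrm{Unreleased}(x)$, $\mathrm{SentCount}(x,n)$, $\mathrm{RecvCount}(x,n)$. A knowledge set $\Phi$ is a finite set of facts; $\Phi\vdash\varphi$ means derivability in first-order logic plus the rules: if no $\mathrm{SentCount}(x,n)\in\Phi$ then $\Phi\vdash\mathrm{SentCount}(x,0)$; likewise for $\mathrm{RecvCount}$; if $\Phi\vdash\mathrm{Created}(x)$ and $\Phi\not\vdash\mathrm{Released}(x)$ then $\Phi\vdash\mathrm{Unreleased}(x)$; if $\Phi\vdash\mathrm{CreatedUsing}(x,y)$ then $\Phi\vdash\mathrm{Created}(y)$. $\mathrm{IncSent}(x,\Phi)$ replaces $\mathrm{SentCount}(x,n)$ by $\mathrm{SentCount}(x,n+1)$ or adds $\mathrm{SentCount}(x,1)$; $\mathrm{IncRecv}$ likewise. Messages: $\mathrm{App}(x,R)$, $\mathrm{Info}(y,z,B)$, $\mathrm{Release}(x,n)$.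 A configuration $(\alpha,\mu,\rho,\chi)$: $\alpha$ maps internal actors to busy $[\Phi]$ or idle $(\Phi)$ states; $\mu$ gives each address its multiset of undelivered (in-transit) messages; receptionists $\rho\subseteq\mathrm{dom}(\alpha)$; external actors $\chi$ disjoint from $\mathrm{dom}(\alpha)$. Initial configuration: one busy actor $A$ with $\{\mathrm{Activated}(x:A\to E),\mathrm{Created}(y:A\to A),\mathrm{Activated}(y:A\to A)\}$, no messages, $\rho=\emptyset$, $\chi=\{E\}$. Events: Spawn$(x,A,B)$: busy $A$, fresh $x,y,B$; $A$ adds $\mathrm{Activated}(x:A\to B)$; new busy $B$ with $\{\mathrm{Created}(x:A\to B),\mathrm{Created}(y:B\to B),\mathrm{Activated}(y:B\to B)\}$. Send$(x,\vec y,\vec z,A,B,\vec C)$: busy $A$ with $\Phi\vdash\mathrm{Activated}(x:A\to B)$ and $\Phi\vdash\mathrm{Activated}(y_i:A\to C_i)$, fresh $z_i$; $A$'s set becomes $\mathrm{IncSent}(x,\Phi)\cup\{\mathrm{CreatedUsing}(y_i,z_i)\}$; $\mathrm{App}(x,\{z_i:B\to C_i\})$ is put in transit to $B$. Receive$(x,B,R)$: idle $B$ consumes $\mathrm{App}(x,R)$ and becomes busy with $\mathrm{IncRecv}(x,\Phi)\cup\{\mathrm{Activated}(z):z\in R\}$. Idle$(A)$: busy $A$ becomes idle. SendInfo$(y,z,A,B,C)$: busy $A$ containing $\mathrm{CreatedUsing}(y:A\to C,z:B\to C)$ removes it, increments the send count of $y$, and puts $\mathrm{Info}(y,z,B)$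 in transit to $C$. Info$(y,z,B,C)$: idle $C$ consumes $\mathrm{Info}(y,z,B)$ and stays idle with $\mathrm{IncRecv}(y,\Phi)\cup\{\mathrm{Created}(z:B\to C)\}$. SendRelease$(x,A,B)$: busy $A$ with set $\Phi\cup\{\mathrm{Activated}(x:A\to B),\mathrm{SentCount}(x,n)\}$, no $\mathrm{CreatedUsing}(x,y)\in\Phi$: set becomes $\Phi$; $\mathrm{Release}(x,n)$ put in transit to $B$. Release$(x,A,B)$: idle $B$ consumes $\mathrm{Release}(x,n)$, only if $\Phi\vdash\mathrm{RecvCount}(x,n)$, and adds $\mathrm{Released}(x)$; $x$ is then released. Compaction$(x,B,C)$: idle $C$ containing $\mathrm{Created}(x:B\to C)$ and $\mathrm{Released}(x)$ removes them and any $\mathrm{RecvCount}(x,n)$. Snapshot$(A,\Phi)$: idle $A$; no change. In$(x,A,R)$: $A\in\rho$, $R$ fresh refobs $x_i:A\to B_i$ with each internal $B_i\in\rho$; $\mathrm{App}(x,R)$ put in transit to $A$; external $B_i$ added to $\chi$. Out$(x,B,R)$: $B\in\chi$ consumes $\mathrm{App}(x,R)$; internal targets of $R$ added to $\rho$. ReleaseOut / InfoOut: Release/Info messages in transit to external actors are removed. A refob is unreleased once created until its target performs Release for it. A chain to $x: A\to B$ in $\kappa=(\alpha,\mu,\rho,\chi)$ is a sequence of unreleased refobs $x_1:A_1\to B,\dots,x_n:A_n\to B$ such that $\alpha(B)\vdash\mathrm{Created}(x_1)$; for every $i<n$, either $A_i\in\mathrm{dom}(\alpha)$ and $\alpha(A_i)\vdash\mathrm{CreatedUsing}(x_i,x_{i+1})$,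 or a message $\mathrm{Info}(x_i,x_{i+1},A_{i+1})$ is in transit to $B$; and $A_n=A$, $x_n=x$. An actor $B$ is in the root set if it is a receptionist or there is a message $\mathrm{App}(x,R)$ in transit to an external actor such that $B$ is the target of some refob in $R$. -}

module Defs where

open import Data.Nat using (ℕ; zero; suc; _≡ᵇ_)
open import Data.Bool using (Bool; true; false; _∧_; _∨_; not; if_then_else_)
open import Data.Maybe using (Maybe; just; nothing; is-just; is-nothing)
open import Data.Product using (Σ; ∃; _×_; _,_; proj₁; proj₂)
open import Data.Sum using (_⊎_)
open import Data.List using (List; []; _∷_; map; _++_; filterᵇ)
open import Data.List.Membership.Propositional using (_∈_; _∉_)
open import Data.List.Relation.Unary.All using (All)
open import Data.List.Relation.Unary.Any using (_─_)
open import Data.List.Relation.Unary.Unique.Propositional using (Unique)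
open import Relation.Binary.PropositionalEquality using (_≡_; _≢_)
open import Relation.Binary.Construct.Closure.ReflexiveTransitive using (Star)
open import Relation.Nullary using (¬_)

Address : Set
Address = ℕ

Token : Set
Token = ℕ

record Refob : Set where
  constructor refob
  field
    token  : Token
    owner  : Address
    target : Address
open Refob public

_==ᴿ_ : Refob → Refob → Bool
refob x A B ==ᴿ refob y C D = (x ≡ᵇ y) ∧ (A ≡ᵇ C) ∧ (B ≡ᵇ D)

data Fact : Set where
  Created      : Refob → Fact
  Released     : Refob → Fact
  CreatedUsing : Refob → Refob → Fact
  Activated    : Refob → Fact
  Unreleased   : Refob → Fact
  SentCount    : Refob → ℕ → Fact
  RecvCount    : Refob → ℕ → Fact

Knowledge : Set
Knowledge = List Fact

-- Derivability, stratified: ⊢₀ contains every rule except the one for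
-- Unreleased (which has a negative premise); ⊢ adds that rule on top.
data _⊢₀_ (Φ : Knowledge) : Fact → Set where
  mem    : ∀ {φ} → φ ∈ Φ → Φ ⊢₀ φ
  sent0  : ∀ {x} → (∀ n → SentCount x n ∉ Φ) → Φ ⊢₀ SentCount x 0
  recv0  : ∀ {x} → (∀ n → RecvCount x n ∉ Φ) → Φ ⊢₀ RecvCount x 0
  cuCrea : ∀ {x y} → Φ ⊢₀ CreatedUsing x y → Φ ⊢₀ Created y

data _⊢_ (Φ : Knowledge) : Fact → Set where
  base  : ∀ {φ} → Φ ⊢₀ φ → Φ ⊢ φ
  unrel : ∀ {x} → Φ ⊢₀ Created x → ¬ (Φ ⊢₀ Released x) → Φ ⊢ Unreleased x

isSentOf isRecvOf isAct isCrea isRel : Refob → Fact → Bool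
isSentOf x (SentCount y _) = x ==ᴿ y
isSentOf x _ = false
isRecvOf x (RecvCount y _) = x ==ᴿ y
isRecvOf x _ = false
isAct x (Activated y) = x ==ᴿ y
isAct x _ = false
isCrea x (Created y) = x ==ᴿ y
isCrea x _ = false
isRel x (Released y) = x ==ᴿ y
isRel x _ = false

isCU : Refob → Refob → Fact → Bool
isCU y z (CreatedUsing y' z') = (y ==ᴿ y') ∧ (z ==ᴿ z')
isCU y z _ = false

discard : (Fact → Bool) → Knowledge → Knowledge
discard p = filterᵇ (λ φ → not (p φ))

sentOf recvOf : Refob → Knowledge → ℕ
sentOf x [] = 0
sentOf x (SentCount y n ∷ Φ) = if x ==ᴿ y then n else sentOf x Φ
sentOf x (_ ∷ Φ) = sentOf x Φ
recvOf x [] = 0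
recvOf x (RecvCount y n ∷ Φ) = if x ==ᴿ y then n else recvOf x Φ
recvOf x (_ ∷ Φ) = recvOf x Φ

IncSent IncRecv : Refob → Knowledge → Knowledge
IncSent x Φ = SentCount x (suc (sentOf x Φ)) ∷ discard (isSentOf x) Φ
IncRecv x Φ = RecvCount x (suc (recvOf x Φ)) ∷ discard (isRecvOf x) Φ

data Msg : Set where
  App     : Refob → List Refob → Msg
  Info    : Refob → Refob → Address → Msg
  Release : Refob → ℕ → Msg

data AState : Set where
  busy : Knowledge → AState
  idle : Knowledge → AState

knowledge : AState → Knowledge
knowledge (busy Φ) = Φ
knowledge (idle Φ) = Φ

-- A configuration (α, μ, ρ, χ) together with ghost bookkeeping:
-- usedT / usedA record every token / address ever used (for freshness),
-- created / released record which refobs were created / released.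
record Config : Set where
  field
    α        : Address → Maybe AState
    μ        : List (Address × Msg)      -- (destination , message) in transit
    ρ        : List Address
    χ        : List Address
    usedT    : List Token
    usedA    : List Address
    created  : List Refob
    released : List Refob
open Config public

upd : (Address → Maybe AState) → Address → AState → Address → Maybe AState
upd f A s C = if C ≡ᵇ A then just s else f C

Internal : Config → Address → Set
Internal κ B = Σ AState (λ s → α κ B ≡ just s)

Unreleased? : Config → Refob → Set
Unreleased? κ x = x ∈ created κ × x ∉ released κ

initial : Address → Address → Token → Token → Config
initial A E x y = record
  { α = upd (λ _ → nothing) A
          (busy (Activated (refob x A E) ∷ Created (refob y A A) ∷ Activated (refob y A A) ∷ []))
  ; μ = []
  ; ρ = []
  ; χ = E ∷ []
  ; usedT = x ∷ y ∷ []
  ; usedA = A ∷ E ∷ []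
  ; created = refob x A E ∷ refob y A A ∷ []
  ; released = []
  }

CU : Refob × Refob → Fact
CU (y , z) = CreatedUsing y z

SendOK : Config → Knowledge → Address → Refob → Refob × Refob → Set
SendOK κ Φ A x (y , z) =
  Φ ⊢ Activated y × owner y ≡ A × owner z ≡ target x × target z ≡ target y
  × token z ∉ usedT κ

InOK : Config → Address → Refob → Set
InOK κ A r = owner r ≡ A × token r ∉ usedT κ × (Internal κ (target r) → target r ∈ ρ κ)

infix 4 _⟶_
data _⟶_ (κ : Config) : Config → Set where
  spawn : ∀ {Φ} (x A B y : ℕ) → α κ A ≡ just (busy Φ)
        → x ∉ usedT κ → y ∉ usedT κ → x ≢ y → B ∉ usedA κ
        → κ ⟶ record κ
            { α = upd (upd (α κ) A (busy (Activated (refob x A B) ∷ Φ))) B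
                    (busy (Created (refob x A B) ∷ Created (refob y B B) ∷ Activated (refob y B B) ∷ []))
            ; usedT = x ∷ y ∷ usedT κ
            ; usedA = B ∷ usedA κ
            ; created = refob x A B ∷ refob y B B ∷ created κ }
  send : ∀ {Φ} (x : Refob) (A : Address) (ps : List (Refob × Refob))
       → α κ A ≡ just (busy Φ) → owner x ≡ A → Φ ⊢ Activated x
       → All (SendOK κ Φ A x) ps
       → Unique (map (λ p → token (proj₂ p)) ps)
       → κ ⟶ record κ
           { α = upd (α κ) A (busy (IncSent x Φ ++ map CU ps))
           ; μ = (target x , App x (map proj₂ ps)) ∷ μ κ
           ; usedT = map (λ p → token (proj₂ p)) ps ++ usedT κ
           ; created = map proj₂ ps ++ created κ }
  receive : ∀ {Φ} (x : Refob) (B : Address) (R : List Refob)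
          → α κ B ≡ just (idle Φ) → (p : (B , App x R) ∈ μ κ)
          → κ ⟶ record κ
              { α = upd (α κ) B (busy (IncRecv x Φ ++ map Activated R))
              ; μ = μ κ ─ p }
  becomeIdle : ∀ {Φ} (A : Address) → α κ A ≡ just (busy Φ)
             → κ ⟶ record κ { α = upd (α κ) A (idle Φ) }
  sendInfo : ∀ {Φ} (y z : Refob) (A : Address)
           → α κ A ≡ just (busy Φ) → owner y ≡ A → target z ≡ target y
           → CreatedUsing y z ∈ Φ
           → κ ⟶ record κ
               { α = upd (α κ) A (busy (IncSent y (discard (isCU y z) Φ)))
               ; μ = (target y , Info y z (owner z)) ∷ μ κ }
  info : ∀ {Φ} (y z : Refob) (B C : Address)
       → α κ C ≡ just (idle Φ) → (p : (C , Info y z B) ∈ μ κ)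
       → κ ⟶ record κ
           { α = upd (α κ) C (idle (Created z ∷ IncRecv y Φ))
           ; μ = μ κ ─ p }
  sendRelease : ∀ {Φ} (x : Refob) (A : Address) (n : ℕ)
              → α κ A ≡ just (busy Φ) → owner x ≡ A
              → Activated x ∈ Φ → Φ ⊢ SentCount x n
              → (∀ y → CreatedUsing x y ∉ Φ)
              → κ ⟶ record κ
                  { α = upd (α κ) A (busy (discard (λ φ → isAct x φ ∨ isSentOf x φ) Φ))
                  ; μ = (target x , Release x n) ∷ μ κ }
  release : ∀ {Φ} (x : Refob) (B : Address) (n : ℕ)
          → α κ B ≡ just (idle Φ) → (p : (B , Release x n) ∈ μ κ)
          → Φ ⊢ RecvCount x n
          → κ ⟶ record κ
              { α = upd (α κ) B (idle (Released x ∷ Φ))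
              ; μ = μ κ ─ p
              ; released = x ∷ released κ }
  compaction : ∀ {Φ} (x : Refob) (C : Address)
             → α κ C ≡ just (idle Φ) → target x ≡ C
             → Created x ∈ Φ → Released x ∈ Φ
             → κ ⟶ record κ
                 { α = upd (α κ) C
                         (idle (discard (λ φ → isCrea x φ ∨ isRel x φ ∨ isRecvOf x φ) Φ)) }
  snapshot : ∀ {Φ} (A : Address) → α κ A ≡ just (idle Φ) → κ ⟶ κ
  inEv : (x : Refob) (A : Address) (R : List Refob)
       → A ∈ ρ κ → target x ≡ A → owner x ∈ χ κ
       → All (InOK κ A) R → Unique (map token R)
       → κ ⟶ record κ
           { μ = (A , App x R) ∷ μ κ
           ; χ = filterᵇ (λ B → is-nothing (α κ B)) (map target R) ++ χ κ
           ; usedT = map token R ++ usedT κ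
           ; usedA = map target R ++ usedA κ
           ; created = R ++ created κ }
  outEv : (x : Refob) (B : Address) (R : List Refob)
        → B ∈ χ κ → (p : (B , App x R) ∈ μ κ)
        → κ ⟶ record κ
            { μ = μ κ ─ p
            ; ρ = filterᵇ (λ C → is-just (α κ C)) (map target R) ++ ρ κ }
  releaseOut : (x : Refob) (B : Address) (n : ℕ)
             → B ∈ χ κ → (p : (B , Release x n) ∈ μ κ)
             → κ ⟶ record κ { μ = μ κ ─ p }
  infoOut : (y z : Refob) (B C : Address)
          → C ∈ χ κ → (p : (C , Info y z B) ∈ μ κ)
          → κ ⟶ record κ { μ = μ κ ─ p }

Reachable : Config → Config → Set
Reachable = Star _⟶_

Link : Config → Address → Refob → Refob → Set
Link κ B xi xj =
  (Σ AState (λ s → α κ (owner xi) ≡ just s × knowledge s ⊢ CreatedUsing xi xj))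
  ⊎ ((B , Info xi xj (owner xj)) ∈ μ κ)

data ChainFrom (κ : Config) (B : Address) : Refob → Refob → Set where
  last : ∀ {x} → Unreleased? κ x → target x ≡ B → ChainFrom κ B x x
  step : ∀ {xi xj x} → Unreleased? κ xi → target xi ≡ B → Link κ B xi xj
       → ChainFrom κ B xj x → ChainFrom κ B xi x

Chain : Config → Refob → Set
Chain κ x = Σ Refob (λ x₁ → Σ AState (λ s →
  α κ (target x) ≡ just s × knowledge s ⊢ Created x₁ × ChainFrom κ (target x) x₁ x))

RootSet : Config → Address → Set
RootSet κ B = B ∈ ρ κ ⊎
  Σ Address (λ C → Σ Refob (λ x → Σ (List Refob) (λ R →
    (C , App x R) ∈ μ κ × C ∈ χ κ × Σ Refob (λ z → z ∈ R × target z ≡ B))))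

-- The lemma follows from an inductive invariant of the transition system. Its core is a
-- counting argument for every refob x : A → B between internal actors: until A sends
-- Release(x, n), the number of messages A has sent along x equals the number B has received
-- plus those still in flight, and afterwards n is exactly that total. So when B accepts
-- Release(x, n) with RecvCount(x, n), no Info along x is in flight and A holds no
-- CreatedUsing(x, _): x ends every chain it lies on, and releasing it breaks none. The other
-- transitions preserve chains or extend them: sending y as z appends CreatedUsing(y, z) to
-- a chain ending in y, SendInfo turns that link into an Info message, and receiving the Info
-- records Created(z) at the target, where a new chain may start. Freshness of tokens and
-- addresses keeps newly created refobs and actors from interfering with existing chains.

module Submission where

open import Defs
open import Data.Nat using (ℕ; zero; suc; _≡ᵇ_; _+_)
open import Data.Nat.Properties using (≡ᵇ⇒≡; _≟_; +-suc; suc-injective; 1+n≢0; m+1+n≢m)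
open import Data.Bool using (Bool; true; false; _∨_; not; if_then_else_; T)
open import Data.Maybe using (Maybe; just; nothing; is-just; is-nothing)
open import Data.Product using (Σ; _×_; _,_; proj₁; proj₂)
open import Data.Sum using (_⊎_; inj₁; inj₂; map₁) renaming (map to ⊎-map)
open import Data.Empty using (⊥; ⊥-elim)
open import Data.Unit using (tt)
open import Data.List using (List; []; _∷_; map; _++_; filterᵇ)
open import Data.List.Membership.Propositional using (_∈_; _∉_)
open import Data.List.Membership.Propositional.Properties using (∈-++⁻; ∈-++⁺ˡ; ∈-++⁺ʳ; ∈-map⁻; ∈-map⁺; ∈-filter⁻; ∈-filter⁺)
open import Relation.Nullary.Decidable using (T?)
open import Relation.Unary using (Decidable)
open import Function using (_∘_; id)
open import Data.List.Relation.Unary.Any using (here; there; _─_)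
open import Data.List.Relation.Unary.Any.Properties using (¬Any[])
open import Data.List.Relation.Unary.All using (All)
open import Relation.Binary.PropositionalEquality
open import Relation.Binary.Construct.Closure.ReflexiveTransitive using (ε; _◅_)
open import Relation.Nullary using (¬_; Dec; yes; no)
import Data.List.Relation.Unary.All as All
open import Data.List.Membership.DecPropositional _≟_ using (_∈?_)

≡ᵇ-refl : ∀ n → (n ≡ᵇ n) ≡ true
≡ᵇ-refl zero = refl
≡ᵇ-refl (suc n) = ≡ᵇ-refl n

≢⇒≡ᵇ≡false : ∀ m n → m ≢ n → (m ≡ᵇ n) ≡ false
≢⇒≡ᵇ≡false m n m≢n with m ≡ᵇ n in eq
... | false = refl
... | true = ⊥-elim (m≢n (≡ᵇ⇒≡ m n (subst T (sym eq) tt)))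

true≢false : true ≢ false
true≢false ()

nothing≢just : ∀ {A : Set} {a : A} → nothing ≢ just a
nothing≢just ()

_≟ᴿ_ : (x y : Refob) → Dec (x ≡ y)
refob a b c ≟ᴿ refob d e f with a ≟ d | b ≟ e | c ≟ f
... | yes refl | yes refl | yes refl = yes refl
... | no a≢d | _ | _ = no λ { refl → a≢d refl }
... | yes _ | no b≢e | _ = no λ { refl → b≢e refl }
... | yes _ | yes _ | no c≢f = no λ { refl → c≢f refl }

==ᴿ-refl : ∀ x → (x ==ᴿ x) ≡ true
==ᴿ-refl (refob a b c) rewrite ≡ᵇ-refl a | ≡ᵇ-refl b | ≡ᵇ-refl c = refl

≢⇒==ᴿ≡false : ∀ x y → x ≢ y → (x ==ᴿ y) ≡ false
≢⇒==ᴿ≡false (refob a b c) (refob d e f) x≢y with a ≟ d | b ≟ e | c ≟ f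
... | yes refl | yes refl | yes refl = ⊥-elim (x≢y refl)
... | no a≢d | _ | _ rewrite ≢⇒≡ᵇ≡false a d a≢d = refl
... | yes refl | no b≢e | _ rewrite ≡ᵇ-refl a | ≢⇒≡ᵇ≡false b e b≢e = refl
... | yes refl | yes refl | no c≢f rewrite ≡ᵇ-refl a | ≡ᵇ-refl b | ≢⇒≡ᵇ≡false c f c≢f = refl

==ᴿ≡true⇒≡ : ∀ x y → (x ==ᴿ y) ≡ true → x ≡ y
==ᴿ≡true⇒≡ x y eq with x ≟ᴿ y
... | yes x≡y = x≡y
... | no x≢y = ⊥-elim (true≢false (trans (sym eq) (≢⇒==ᴿ≡false x y x≢y)))

upd-≡ : ∀ f A s → upd f A s A ≡ just s
upd-≡ f A s rewrite ≡ᵇ-refl A = refl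

upd-≢ : ∀ f A s X → X ≢ A → upd f A s X ≡ f X
upd-≢ f A s X X≢A rewrite ≢⇒≡ᵇ≡false X A X≢A = refl

kept? : (p : Fact → Bool) → Decidable (λ φ → T (not (p φ)))
kept? p φ = T? (not (p φ))

∈-discard⁻ : ∀ {p φ} Φ → φ ∈ discard p Φ → φ ∈ Φ
∈-discard⁻ {p} Φ m = proj₁ (∈-filter⁻ (kept? p) {xs = Φ} m)

∈-discard⇒false : ∀ {p φ} Φ → φ ∈ discard p Φ → p φ ≡ false
∈-discard⇒false {p} {φ} Φ m with p φ | proj₂ (∈-filter⁻ (kept? p) {xs = Φ} m)
... | false | _ = refl

∈-discard⁺ : ∀ {p φ} Φ → φ ∈ Φ → p φ ≡ false → φ ∈ discard p Φ
∈-discard⁺ {p} Φ m pφ≡false = ∈-filter⁺ (kept? p) m (subst (T ∘ not) (sym pφ≡false) tt)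

∈-─⁻ : ∀ {A : Set} {e e' : A} (l : List A) (p : e ∈ l) → e' ∈ (l ─ p) → e' ∈ l
∈-─⁻ (x ∷ l) (here _) m = there m
∈-─⁻ (x ∷ l) (there p) (here e) = here e
∈-─⁻ (x ∷ l) (there p) (there m) = there (∈-─⁻ l p m)

∈-─⁺ : ∀ {A : Set} {e e' : A} (l : List A) (p : e ∈ l) → e' ∈ l → e' ≢ e → e' ∈ (l ─ p)
∈-─⁺ (x ∷ l) (here refl) (here refl) e'≢e = ⊥-elim (e'≢e refl)
∈-─⁺ (x ∷ l) (here _) (there m) _ = m
∈-─⁺ (x ∷ l) (there p) (here e) _ = here e
∈-─⁺ (x ∷ l) (there p) (there m) e'≢e = there (∈-─⁺ l p m e'≢e)

count : ∀ {A : Set} → (A → Bool) → List A → ℕ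
count f [] = 0
count f (x ∷ l) = if f x then suc (count f l) else count f l

count-─ : ∀ {A : Set} {e : A} (f : A → Bool) (l : List A) (p : e ∈ l)
        → count f l ≡ (if f e then suc (count f (l ─ p)) else count f (l ─ p))
count-─ f (x ∷ l) (here refl) with f x
... | true = refl
... | false = refl
count-─ {e = e} f (x ∷ l) (there p) with f x | count-─ f l p
... | true | r rewrite r with f e
... | true = refl
... | false = refl
count-─ {e = e} f (x ∷ l) (there p) | false | r = r

count-─-false : ∀ {A : Set} {e : A} (f : A → Bool) (l : List A) (p : e ∈ l) → f e ≡ false → count f (l ─ p) ≡ count f l
count-─-false f l p fe rewrite count-─ f l p | fe = refl

count-─-true : ∀ {A : Set} {e : A} (f : A → Bool) (l : List A) (p : e ∈ l) → f e ≡ true → count f l ≡ suc (count f (l ─ p))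
count-─-true f l p fe rewrite count-─ f l p | fe = refl

count-─≡0 : ∀ {A : Set} {e : A} (f : A → Bool) (l : List A) (p : e ∈ l) → count f l ≡ 0 → count f (l ─ p) ≡ 0
count-─≡0 {e = e} f l p c≡0 with f e in fe
... | false = trans (count-─-false f l p fe) c≡0
... | true = ⊥-elim (1+n≢0 (trans (sym (count-─-true f l p fe)) c≡0))

count≡0 : ∀ {A : Set} (f : A → Bool) (l : List A) → (∀ {e} → e ∈ l → f e ≡ false) → count f l ≡ 0
count≡0 f [] h = refl
count≡0 f (x ∷ l) h rewrite h (here refl) = count≡0 f l (λ m → h (there m))

count≡suc : ∀ {A : Set} {e : A} (f : A → Bool) (l : List A) → e ∈ l → f e ≡ true → Σ ℕ λ k → count f l ≡ suc k
count≡suc f (x ∷ l) (here refl) fe rewrite fe = _ , refl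
count≡suc f (x ∷ l) (there m) fe with f x
... | true = _ , refl
... | false = count≡suc f l m fe

data CountView (Count : Refob → ℕ → Fact) : Fact → Set where
  counted : ∀ y n → CountView Count (Count y n)
  uncounted : ∀ {φ} → (∀ {y n} → φ ≢ Count y n) → CountView Count φ

module Counter
  (Count : Refob → ℕ → Fact)
  (countOf : Refob → Knowledge → ℕ)
  (isCountOf : Refob → Fact → Bool)
  (Count-injective : ∀ {x y n k} → Count x n ≡ Count y k → x ≡ y × n ≡ k)
  (view : ∀ φ → CountView Count φ)
  (countOf-[] : ∀ x → countOf x [] ≡ 0)
  (countOf-counted : ∀ x y n Φ → countOf x (Count y n ∷ Φ) ≡ (if x ==ᴿ y then n else countOf x Φ))
  (countOf-uncounted : ∀ x {φ} Φ → (∀ {y n} → φ ≢ Count y n) → countOf x (φ ∷ Φ) ≡ countOf x Φ)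
  (isCountOf-counted : ∀ x y n → isCountOf x (Count y n) ≡ (x ==ᴿ y))
  where

  Free : Knowledge → Set
  Free L = ∀ {x n} → Count x n ∉ L

  Consistent : Knowledge → Set
  Consistent Φ = ∀ {x n} → Count x n ∈ Φ → n ≡ countOf x Φ

  Inc : Refob → Knowledge → Knowledge
  Inc x Φ = Count x (suc (countOf x Φ)) ∷ discard (isCountOf x) Φ

  countOf-∉ : ∀ x Φ → (∀ n → Count x n ∉ Φ) → countOf x Φ ≡ 0
  countOf-∉ x [] _ = countOf-[] x
  countOf-∉ x (φ ∷ Φ) h with view φ
  ... | uncounted φ≢ rewrite countOf-uncounted x Φ φ≢ = countOf-∉ x Φ (λ n → h n ∘ there)
  ... | counted y k with x ≟ᴿ y
  ...   | yes refl = ⊥-elim (h k (here refl))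
  ...   | no x≢y rewrite countOf-counted x y k Φ | ≢⇒==ᴿ≡false x y x≢y = countOf-∉ x Φ (λ n → h n ∘ there)

  countOf-++ : ∀ x Φ L → Free L → countOf x (Φ ++ L) ≡ countOf x Φ
  countOf-++ x [] L free = trans (countOf-∉ x L (λ _ → free)) (sym (countOf-[] x))
  countOf-++ x (φ ∷ Φ) L free with view φ
  ... | uncounted φ≢ rewrite countOf-uncounted x (Φ ++ L) φ≢ | countOf-uncounted x Φ φ≢ = countOf-++ x Φ L free
  ... | counted y k rewrite countOf-counted x y k (Φ ++ L) | countOf-counted x y k Φ with x ==ᴿ y
  ...   | true = refl
  ...   | false = countOf-++ x Φ L free

  countOf-discard : ∀ p x Φ → (∀ n → p (Count x n) ≡ false) → countOf x (discard p Φ) ≡ countOf x Φ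
  countOf-discard p x [] _ = refl
  countOf-discard p x (φ ∷ Φ) kept with view φ
  ... | uncounted φ≢ with p φ
  ...   | true rewrite countOf-uncounted x Φ φ≢ = countOf-discard p x Φ kept
  ...   | false rewrite countOf-uncounted x (discard p Φ) φ≢ | countOf-uncounted x Φ φ≢ = countOf-discard p x Φ kept
  countOf-discard p x (φ ∷ Φ) kept | counted y k with p (Count y k) in p≡
  ...   | false rewrite countOf-counted x y k (discard p Φ) | countOf-counted x y k Φ with x ==ᴿ y
  ...     | true = refl
  ...     | false = countOf-discard p x Φ kept
  countOf-discard p x (φ ∷ Φ) kept | counted y k | true with x ≟ᴿ y
  ...     | yes refl = ⊥-elim (true≢false (trans (sym p≡) (kept k)))
  ...     | no x≢y rewrite countOf-counted x y k Φ | ≢⇒==ᴿ≡false x y x≢y = countOf-discard p x Φ kept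

  countOf-Inc : ∀ y Φ → countOf y (Inc y Φ) ≡ suc (countOf y Φ)
  countOf-Inc y Φ rewrite countOf-counted y y (suc (countOf y Φ)) (discard (isCountOf y) Φ) | ==ᴿ-refl y = refl

  countOf-Inc-≢ : ∀ x y Φ → x ≢ y → countOf x (Inc y Φ) ≡ countOf x Φ
  countOf-Inc-≢ x y Φ x≢y rewrite countOf-counted x y (suc (countOf y Φ)) (discard (isCountOf y) Φ) | ≢⇒==ᴿ≡false x y x≢y =
    countOf-discard (isCountOf y) x Φ (λ k → trans (isCountOf-counted y x k) (≢⇒==ᴿ≡false y x (x≢y ∘ sym)))

  Consistent-++ : ∀ Φ L → Free L → Consistent Φ → Consistent (Φ ++ L)
  Consistent-++ Φ L free c {x} m with ∈-++⁻ Φ m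
  ... | inj₁ m' = trans (c m') (sym (countOf-++ x Φ L free))
  ... | inj₂ m' = ⊥-elim (free m')

  Consistent-discard : ∀ p Φ → (∀ x n k → p (Count x n) ≡ p (Count x k)) → Consistent Φ → Consistent (discard p Φ)
  Consistent-discard p Φ uniform c {x} {n} m =
    trans (c (∈-discard⁻ Φ m)) (sym (countOf-discard p x Φ (λ k → trans (uniform x k n) (∈-discard⇒false Φ m))))

  Consistent-Inc : ∀ y Φ → Consistent Φ → Consistent (Inc y Φ)
  Consistent-Inc y Φ c (here eq) with Count-injective eq
  ... | refl , refl = sym (countOf-Inc y Φ)
  Consistent-Inc y Φ c {x} {n} (there m) with x ≟ᴿ y
  ... | yes refl = ⊥-elim (true≢false (trans (sym (==ᴿ-refl x)) (trans (sym (isCountOf-counted x x n)) (∈-discard⇒false Φ m))))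
  ... | no x≢y = trans (c (∈-discard⁻ Φ m)) (sym (countOf-Inc-≢ x y Φ x≢y))

  Consistent-∷ : ∀ φ Φ → (∀ {x n} → φ ≢ Count x n) → Consistent Φ → Consistent (φ ∷ Φ)
  Consistent-∷ φ Φ φ≢ c (here refl) = ⊥-elim (φ≢ refl)
  Consistent-∷ φ Φ φ≢ c {x} (there m) = trans (c m) (sym (countOf-uncounted x Φ φ≢))

SentCount-injective : ∀ {x y n k} → SentCount x n ≡ SentCount y k → x ≡ y × n ≡ k
SentCount-injective refl = refl , refl

sentView : ∀ φ → CountView SentCount φ
sentView (Created _) = uncounted λ ()
sentView (Released _) = uncounted λ ()
sentView (CreatedUsing _ _) = uncounted λ ()
sentView (Activated _) = uncounted λ ()
sentView (Unreleased _) = uncounted λ ()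
sentView (SentCount y n) = counted y n
sentView (RecvCount _ _) = uncounted λ ()

sentOf-uncounted : ∀ x {φ} Φ → (∀ {y n} → φ ≢ SentCount y n) → sentOf x (φ ∷ Φ) ≡ sentOf x Φ
sentOf-uncounted x {Created _} Φ _ = refl
sentOf-uncounted x {Released _} Φ _ = refl
sentOf-uncounted x {CreatedUsing _ _} Φ _ = refl
sentOf-uncounted x {Activated _} Φ _ = refl
sentOf-uncounted x {Unreleased _} Φ _ = refl
sentOf-uncounted x {SentCount _ _} Φ φ≢ = ⊥-elim (φ≢ refl)
sentOf-uncounted x {RecvCount _ _} Φ _ = refl

RecvCount-injective : ∀ {x y n k} → RecvCount x n ≡ RecvCount y k → x ≡ y × n ≡ k
RecvCount-injective refl = refl , refl

recvView : ∀ φ → CountView RecvCount φ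
recvView (Created _) = uncounted λ ()
recvView (Released _) = uncounted λ ()
recvView (CreatedUsing _ _) = uncounted λ ()
recvView (Activated _) = uncounted λ ()
recvView (Unreleased _) = uncounted λ ()
recvView (SentCount _ _) = uncounted λ ()
recvView (RecvCount y n) = counted y n

recvOf-uncounted : ∀ x {φ} Φ → (∀ {y n} → φ ≢ RecvCount y n) → recvOf x (φ ∷ Φ) ≡ recvOf x Φ
recvOf-uncounted x {Created _} Φ _ = refl
recvOf-uncounted x {Released _} Φ _ = refl
recvOf-uncounted x {CreatedUsing _ _} Φ _ = refl
recvOf-uncounted x {Activated _} Φ _ = refl
recvOf-uncounted x {Unreleased _} Φ _ = refl
recvOf-uncounted x {SentCount _ _} Φ _ = refl
recvOf-uncounted x {RecvCount _ _} Φ φ≢ = ⊥-elim (φ≢ refl)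

module Sent = Counter SentCount sentOf isSentOf SentCount-injective sentView (λ _ → refl) (λ _ _ _ _ → refl) sentOf-uncounted (λ _ _ _ → refl)
module Recv = Counter RecvCount recvOf isRecvOf RecvCount-injective recvView (λ _ → refl) (λ _ _ _ _ → refl) recvOf-uncounted (λ _ _ _ → refl)

⊢SentCount⇒sentOf : ∀ {x n} Φ → Sent.Consistent Φ → Φ ⊢ SentCount x n → n ≡ sentOf x Φ
⊢SentCount⇒sentOf Φ c (base (mem m)) = c m
⊢SentCount⇒sentOf {x} Φ c (base (sent0 h)) = sym (Sent.countOf-∉ x Φ h)

⊢RecvCount⇒recvOf : ∀ {x n} Φ → Recv.Consistent Φ → Φ ⊢ RecvCount x n → n ≡ recvOf x Φ
⊢RecvCount⇒recvOf Φ c (base (mem m)) = c m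
⊢RecvCount⇒recvOf {x} Φ c (base (recv0 h)) = sym (Recv.countOf-∉ x Φ h)

knowledgeᵐ : Maybe AState → Knowledge
knowledgeᵐ (just s) = knowledge s
knowledgeᵐ nothing = []

knowledgeAt : Config → Address → Knowledge
knowledgeAt κ A = knowledgeᵐ (α κ A)

knowledgeAt-internal : ∀ κ A {φ} → φ ∈ knowledgeAt κ A → Internal κ A
knowledgeAt-internal κ A m with α κ A
... | just s = s , refl
... | nothing = ⊥-elim (¬Any[] m)

knowledgeAt-≡ : ∀ κ A {s} → α κ A ≡ just s → knowledgeAt κ A ≡ knowledge s
knowledgeAt-≡ κ A eq rewrite eq = refl

factRefobs : Fact → List Refob
factRefobs (Created x) = x ∷ []
factRefobs (Released x) = x ∷ []
factRefobs (CreatedUsing x y) = x ∷ y ∷ []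
factRefobs (Activated x) = x ∷ []
factRefobs (Unreleased x) = x ∷ []
factRefobs (SentCount x _) = x ∷ []
factRefobs (RecvCount x _) = x ∷ []

msgRefobs : Msg → List Refob
msgRefobs (App x R) = x ∷ R
msgRefobs (Info y z _) = y ∷ z ∷ []
msgRefobs (Release x _) = x ∷ []

-- A refob that is not in use differs from every refob occurring in the configuration.
InUse : Config → Refob → Set
InUse κ r = owner r ∈ usedA κ × target r ∈ usedA κ × (Internal κ (owner r) → token r ∈ usedT κ)

sentAlong : Refob → Address × Msg → Bool
sentAlong x (_ , App y _) = x ==ᴿ y
sentAlong x (_ , Info y _ _) = x ==ᴿ y
sentAlong x (_ , Release _ _) = false

inR : Refob → List Refob → Bool
inR x [] = false
inR x (y ∷ R) = (x ==ᴿ y) ∨ inR x R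

carries : Refob → Address × Msg → Bool
carries x (_ , App _ R) = inR x R
carries x (_ , Info _ _ _) = false
carries x (_ , Release _ _) = false

inFlight : Refob → List (Address × Msg) → ℕ
inFlight x = count (sentAlong x)

carriers : Refob → List (Address × Msg) → ℕ
carriers x = count (carries x)

NoReleaseMsg : Config → Refob → Set
NoReleaseMsg κ x = ∀ D n → (D , Release x n) ∉ μ κ

CarriedOnce : Config → Refob → Set
CarriedOnce κ x = carriers x (μ κ) ≡ 0
  ⊎ (carriers x (μ κ) ≡ 1 × Activated x ∉ knowledgeAt κ (owner x) × NoReleaseMsg κ x × x ∉ released κ)

Balance : Config → Refob → Set
Balance κ x =
  (NoReleaseMsg κ x × sentOf x (knowledgeAt κ (owner x)) ≡ recvOf x (knowledgeAt κ (target x)) + inFlight x (μ κ))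
  ⊎ ((∀ D n → (D , Release x n) ∈ μ κ → n ≡ recvOf x (knowledgeAt κ (target x)) + inFlight x (μ κ))
     × Activated x ∉ knowledgeAt κ (owner x) × (∀ v → CreatedUsing x v ∉ knowledgeAt κ (owner x)) × carriers x (μ κ) ≡ 0)

LinkIn : Config → Address → Refob → Refob → Set
LinkIn κ B xi xj = CreatedUsing xi xj ∈ knowledgeAt κ (owner xi) ⊎ (B , Info xi xj (owner xj)) ∈ μ κ

⊢CreatedUsing⇒∈ : ∀ {Φ x y} → Φ ⊢ CreatedUsing x y → CreatedUsing x y ∈ Φ
⊢CreatedUsing⇒∈ (base (mem m)) = m

⊢Activated⇒∈ : ∀ {Φ x} → Φ ⊢ Activated x → Activated x ∈ Φ
⊢Activated⇒∈ (base (mem m)) = m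

Link⇒LinkIn : ∀ κ {B xi xj} → Link κ B xi xj → LinkIn κ B xi xj
Link⇒LinkIn κ {B} {xi} (inj₁ (s , eq , d)) = inj₁ (subst (CreatedUsing _ _ ∈_) (sym (knowledgeAt-≡ κ (owner xi) eq)) (⊢CreatedUsing⇒∈ d))
Link⇒LinkIn κ (inj₂ m) = inj₂ m

LinkIn⇒Link : ∀ κ {B xi xj} → LinkIn κ B xi xj → Link κ B xi xj
LinkIn⇒Link κ {B} {xi} (inj₁ m) with knowledgeAt-internal κ (owner xi) m
... | s , eq = inj₁ (s , eq , base (mem (subst (CreatedUsing _ _ ∈_) (knowledgeAt-≡ κ (owner xi) eq) m)))
LinkIn⇒Link κ (inj₂ m) = inj₂ m

LocalChain : Config → Refob → Set
LocalChain κ x = Σ Refob λ x₁ → Created x₁ ∈ knowledgeAt κ (target x) × ChainFrom κ (target x) x₁ x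

LocalChain⇒Chain : ∀ κ x → Internal κ (target x) → LocalChain κ x → Chain κ x
LocalChain⇒Chain κ x (s , eq) (x₁ , h , c) = x₁ , s , eq , base (mem (subst (Created x₁ ∈_) (knowledgeAt-≡ κ (target x) eq) h)) , c

head-unreleased : ∀ {κ B x w} → ChainFrom κ B x w → Unreleased? κ x
head-unreleased (last u _) = u
head-unreleased (step u _ _ _) = u

last-unreleased : ∀ {κ B x w} → ChainFrom κ B x w → Unreleased? κ w
last-unreleased (last u _) = u
last-unreleased (step _ _ _ c) = last-unreleased c

ChainFrom-snoc : ∀ {κ B x₁ y z} → ChainFrom κ B x₁ y → LinkIn κ B y z → Unreleased? κ z → target z ≡ B → ChainFrom κ B x₁ z
ChainFrom-snoc {κ} (last u t) l uz tz = step u t (LinkIn⇒Link κ l) (last uz tz)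
ChainFrom-snoc {κ} (step u t l c) l' uz tz = step u t l (ChainFrom-snoc c l' uz tz)

-- A chain survives a step if each link survives or, where one does not, its successor is
-- now known as Created to B, so that the chain can be restarted there.
record ChainTransfer (κ κ' : Config) (B : Address) : Set where
  field
    keeps-unreleased : ∀ {xi xj} → Unreleased? κ xi → target xi ≡ B → LinkIn κ B xi xj → Unreleased? κ' xi
    keeps-link : ∀ {xi xj} → Unreleased? κ xi → target xi ≡ B → LinkIn κ B xi xj → LinkIn κ' B xi xj ⊎ Created xj ∈ knowledgeAt κ' B
    keeps-head : ∀ {x₁} → Unreleased? κ x₁ → Created x₁ ∈ knowledgeAt κ B → Created x₁ ∈ knowledgeAt κ' B

module _ {κ κ' : Config} {B : Address} (T : ChainTransfer κ κ' B) where
  open ChainTransfer T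
  private
    go : ∀ {xi w} → ChainFrom κ B xi w
       → Σ Refob (λ y → Created y ∈ knowledgeAt κ' B × (ChainFrom κ' B xi w → ChainFrom κ' B y w))
       → Unreleased? κ' w → Σ Refob (λ y → Created y ∈ knowledgeAt κ' B × ChainFrom κ' B y w)
    go (last u t) (y , hy , f) u' = y , hy , f (last u' t)
    go (step {xj = xj} u t l c) (y , hy , f) u' with keeps-link u t (Link⇒LinkIn κ l)
    ... | inj₁ l' = go c (y , hy , λ c′ → f (step (keeps-unreleased u t (Link⇒LinkIn κ l)) t (LinkIn⇒Link κ' l') c′)) u'
    ... | inj₂ hj = go c (xj , hj , λ c′ → c′) u'

  transfer : ∀ {x₁ w} → Created x₁ ∈ knowledgeAt κ B → ChainFrom κ B x₁ w → Unreleased? κ' w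
            → Σ Refob (λ y → Created y ∈ knowledgeAt κ' B × ChainFrom κ' B y w)
  transfer h c u' = go c (_ , keeps-head (head-unreleased c) h , λ z → z) u'

LocalChain-transfer : ∀ {κ κ'} x → ChainTransfer κ κ' (target x) → LocalChain κ x → Unreleased? κ' x → LocalChain κ' x
LocalChain-transfer x T (x₁ , h , c) u' = transfer T h c u'

record Invariant (κ : Config) : Set where
  field
    internal-used         : ∀ {A} → Internal κ A → A ∈ usedA κ
    external-absent       : ∀ {A} → A ∈ χ κ → α κ A ≡ nothing
    external-used         : ∀ {A} → A ∈ χ κ → A ∈ usedA κ
    receptionist-internal : ∀ {A} → A ∈ ρ κ → Internal κ A
    fact-inUse            : ∀ {A φ r} → φ ∈ knowledgeAt κ A → r ∈ factRefobs φ → InUse κ r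
    msg-inUse             : ∀ {e r} → e ∈ μ κ → r ∈ msgRefobs (proj₂ e) → InUse κ r
    created-inUse         : ∀ {r} → r ∈ created κ → owner r ∈ usedA κ × target r ∈ usedA κ × token r ∈ usedT κ
    released-created      : ∀ {r} → r ∈ released κ → r ∈ created κ × Internal κ (owner r)
    app-wf                : ∀ {D x R} → (D , App x R) ∈ μ κ → target x ≡ D × (∀ {z} → z ∈ R → owner z ≡ D × z ∈ created κ)
    info-wf               : ∀ {D y z B} → (D , Info y z B) ∈ μ κ → target y ≡ D × Internal κ (owner y)
    release-wf            : ∀ {D x n} → (D , Release x n) ∈ μ κ → target x ≡ D × Internal κ (owner x) × x ∈ created κ
    activated-wf          : ∀ {A x} → Activated x ∈ knowledgeAt κ A
                          → owner x ≡ A × x ∈ created κ × x ∉ released κ × NoReleaseMsg κ x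
    createdUsing-wf       : ∀ {A u v} → CreatedUsing u v ∈ knowledgeAt κ A → owner u ≡ A × NoReleaseMsg κ u
    released-recorded     : ∀ {A x} → Released x ∈ knowledgeAt κ A → x ∈ released κ
    sent-consistent       : ∀ {A} → Sent.Consistent (knowledgeAt κ A)
    recv-consistent       : ∀ {A} → Recv.Consistent (knowledgeAt κ A)
    balanced              : ∀ x → Internal κ (owner x) → Internal κ (target x) → x ∉ released κ → Balance κ x
    carried-once          : ∀ x → Internal κ (owner x) → CarriedOnce κ x
    chain-unrooted        : ∀ x → Unreleased? κ x → Internal κ (target x) → target x ∉ ρ κ → LocalChain κ x
    chain-receptionist    : ∀ {B} → B ∈ ρ κ → Σ Refob λ y → target y ≡ B × owner y ∈ χ κ × LocalChain κ y
    chain-exported        : ∀ {C x R z} → (C , App x R) ∈ μ κ → α κ C ≡ nothing → z ∈ R → Internal κ (target z)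
                          → LocalChain κ z ⊎ target z ∈ ρ κ

module Initial (A₀ E₀ x₀ y₀ : ℕ) (A₀≢E₀ : A₀ ≢ E₀) where
  κ₀ : Config
  κ₀ = initial A₀ E₀ x₀ y₀
  Φ₀ : Knowledge
  Φ₀ = Activated (refob x₀ A₀ E₀) ∷ Created (refob y₀ A₀ A₀) ∷ Activated (refob y₀ A₀ A₀) ∷ []

  internal₀ : ∀ {X} → Internal κ₀ X → X ≡ A₀
  internal₀ {X} (s , eq) with X ≟ A₀
  ... | yes e = e
  ... | no n = ⊥-elim (nothing≢just (trans (sym (upd-≢ (λ _ → nothing) A₀ _ X n)) eq))

  knowledgeA₀ : knowledgeAt κ₀ A₀ ≡ Φ₀
  knowledgeA₀ rewrite upd-≡ (λ _ → nothing) A₀ (busy Φ₀) = refl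

  knowledge₀ : ∀ X → knowledgeAt κ₀ X ≡ Φ₀ ⊎ knowledgeAt κ₀ X ≡ []
  knowledge₀ X with X ≟ A₀
  ... | yes refl = inj₁ knowledgeA₀
  ... | no n rewrite upd-≢ (λ _ → nothing) A₀ (busy Φ₀) X n = inj₂ refl

  ∈Φ₀ : ∀ X {φ} → φ ∈ knowledgeAt κ₀ X → φ ∈ Φ₀
  ∈Φ₀ X m with knowledge₀ X
  ... | inj₁ e = subst (_ ∈_) e m
  ... | inj₂ e = ⊥-elim (¬Any[] (subst (_ ∈_) e m))

  sentOf₀ : ∀ x X → sentOf x (knowledgeAt κ₀ X) ≡ 0
  sentOf₀ x X with knowledge₀ X
  ... | inj₁ e rewrite e = refl
  ... | inj₂ e rewrite e = refl

  recvOf₀ : ∀ x X → recvOf x (knowledgeAt κ₀ X) ≡ 0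
  recvOf₀ x X with knowledge₀ X
  ... | inj₁ e rewrite e = refl
  ... | inj₂ e rewrite e = refl

  initial-invariant : Invariant κ₀
  initial-invariant = record
    { internal-used = λ {A} i → subst (_∈ (A₀ ∷ E₀ ∷ [])) (sym (internal₀ {A} i)) (here refl)
    ; external-absent = λ { (here refl) → upd-≢ (λ _ → nothing) A₀ _ E₀ (A₀≢E₀ ∘ sym) ; (there ()) }
    ; external-used = λ { (here refl) → there (here refl) ; (there ()) }
    ; receptionist-internal = λ ()
    ; fact-inUse = λ {A} → fact-inUse′ {A}
    ; msg-inUse = λ ()
    ; created-inUse = λ { (here refl) → here refl , there (here refl) , here refl
                ; (there (here refl)) → here refl , here refl , there (here refl)
                ; (there (there ())) }
    ; released-created = λ ()
    ; app-wf = λ ()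
    ; info-wf = λ ()
    ; release-wf = λ ()
    ; activated-wf = λ {A} → activated-wf′ {A}
    ; createdUsing-wf = λ {A} m → ⊥-elim (CreatedUsing∉Φ₀ (∈Φ₀ A m))
    ; released-recorded = λ {A} m → ⊥-elim (Released∉Φ₀ (∈Φ₀ A m))
    ; sent-consistent = λ {A} m → ⊥-elim (SentCount∉Φ₀ (∈Φ₀ A m))
    ; recv-consistent = λ {A} m → ⊥-elim (RecvCount∉Φ₀ (∈Φ₀ A m))
    ; balanced = λ x _ _ _ → inj₁ ((λ _ _ ()) , trans (sentOf₀ x (owner x)) (sym (cong (_+ 0) (recvOf₀ x (target x)))))
    ; carried-once = λ _ _ → inj₁ refl
    ; chain-unrooted = chain-unrooted′
    ; chain-receptionist = λ ()
    ; chain-exported = λ ()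
    }
    where
    fact-inUse′ : ∀ {A φ r} → φ ∈ knowledgeAt κ₀ A → r ∈ factRefobs φ → InUse κ₀ r
    fact-inUse′ {A} m rm with ∈Φ₀ A m
    fact-inUse′ m (here refl) | here refl = here refl , there (here refl) , λ _ → here refl
    fact-inUse′ m (here refl) | there (here refl) = here refl , here refl , λ _ → there (here refl)
    fact-inUse′ m (here refl) | there (there (here refl)) = here refl , here refl , λ _ → there (here refl)
    activated-wf′ : ∀ {A x} → Activated x ∈ knowledgeAt κ₀ A → owner x ≡ A × x ∈ created κ₀ × x ∉ released κ₀ × NoReleaseMsg κ₀ x
    activated-wf′ {A} m with knowledgeAt-internal κ₀ A m | ∈Φ₀ A m
    ... | i | here refl = sym (internal₀ i) , here refl , (λ ()) , λ _ _ ()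
    ... | i | there (there (here refl)) = sym (internal₀ i) , there (here refl) , (λ ()) , λ _ _ ()
    CreatedUsing∉Φ₀ : ∀ {u v} → CreatedUsing u v ∉ Φ₀
    CreatedUsing∉Φ₀ (there (there (there ())))
    Released∉Φ₀ : ∀ {x} → Released x ∉ Φ₀
    Released∉Φ₀ (there (there (there ())))
    SentCount∉Φ₀ : ∀ {x n} → SentCount x n ∉ Φ₀
    SentCount∉Φ₀ (there (there (there ())))
    RecvCount∉Φ₀ : ∀ {x n} → RecvCount x n ∉ Φ₀
    RecvCount∉Φ₀ (there (there (there ())))
    chain-unrooted′ : ∀ x → Unreleased? κ₀ x → Internal κ₀ (target x) → target x ∉ ρ κ₀ → LocalChain κ₀ x
    chain-unrooted′ x (here refl , _) i _ = ⊥-elim (A₀≢E₀ (sym (internal₀ i)))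
    chain-unrooted′ x (there (here refl) , u) i _ = x , subst (Created x ∈_) (sym knowledgeA₀) (there (here refl)) , last (there (here refl) , (λ ())) refl

module Update (κ : Config) (A : Address) (st : AState) {s0 : AState} (eqA : α κ A ≡ just s0) where
  f : Address → Maybe AState
  f = upd (α κ) A st

  knowledge-here : knowledgeᵐ (f A) ≡ knowledge st
  knowledge-here rewrite upd-≡ (α κ) A st = refl

  knowledge-elsewhere : ∀ {X} → X ≢ A → knowledgeᵐ (f X) ≡ knowledgeAt κ X
  knowledge-elsewhere {X} n rewrite upd-≢ (α κ) A st X n = refl

  i→ : ∀ {X} → Internal κ X → Σ AState (λ s → f X ≡ just s)
  i→ {X} (s , e) with X ≟ A
  ... | yes refl = _ , upd-≡ (α κ) X st
  ... | no n = s , trans (upd-≢ (α κ) A st X n) e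

  i← : ∀ {X} → Σ AState (λ s → f X ≡ just s) → Internal κ X
  i← {X} (s , e) with X ≟ A
  ... | yes refl = _ , eqA
  ... | no n = s , trans (sym (upd-≢ (α κ) A st X n)) e

  nothing← : ∀ {X} → f X ≡ nothing → α κ X ≡ nothing
  nothing← {X} e with X ≟ A
  ... | yes refl = ⊥-elim (nothing≢just (sym (trans (sym (upd-≡ (α κ) X st)) e)))
  ... | no n = trans (sym (upd-≢ (α κ) A st X n)) e

  nothing→ : ∀ {X} → α κ X ≡ nothing → f X ≡ nothing
  nothing→ {X} e with X ≟ A
  ... | yes refl = ⊥-elim (nothing≢just (trans (sym e) eqA))
  ... | no n = trans (upd-≢ (α κ) A st X n) e

  ∈-updated⁻ : ∀ {X φ} → φ ∈ knowledgeᵐ (f X) → (X ≡ A × φ ∈ knowledge st) ⊎ (X ≢ A × φ ∈ knowledgeAt κ X)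
  ∈-updated⁻ {X} m with X ≟ A
  ... | yes refl = inj₁ (refl , subst (_ ∈_) knowledge-here m)
  ... | no n = inj₂ (n , subst (_ ∈_) (knowledge-elsewhere n) m)

  ∈-here⁺ : ∀ {φ} → φ ∈ knowledge st → φ ∈ knowledgeᵐ (f A)
  ∈-here⁺ m = subst (_ ∈_) (sym knowledge-here) m

  ∈-elsewhere⁺ : ∀ {X φ} → X ≢ A → φ ∈ knowledgeAt κ X → φ ∈ knowledgeᵐ (f X)
  ∈-elsewhere⁺ n m = subst (_ ∈_) (sym (knowledge-elsewhere n)) m

  all-knowledge : (P : Knowledge → Set) → P (knowledge st) → (∀ {X} → P (knowledgeAt κ X)) → ∀ {X} → P (knowledgeᵐ (f X))
  all-knowledge P pa po {X} with X ≟ A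
  ... | yes refl = subst P (sym knowledge-here) pa
  ... | no n = subst P (sym (knowledge-elsewhere n)) po

  knowledge-agrees : ∀ {B : Set} (g : Knowledge → B) → g (knowledge st) ≡ g (knowledgeAt κ A) → ∀ X → g (knowledgeᵐ (f X)) ≡ g (knowledgeAt κ X)
  knowledge-agrees g e X with X ≟ A
  ... | yes refl = trans (cong g knowledge-here) e
  ... | no n = cong g (knowledge-elsewhere n)

  kept∈-from : ∀ {φ} → (φ ∈ knowledgeAt κ A → φ ∈ knowledge st) → ∀ {X} → φ ∈ knowledgeAt κ X → φ ∈ knowledgeᵐ (f X)
  kept∈-from h {X} m with X ≟ A
  ... | yes refl = ∈-here⁺ (h m)
  ... | no n = ∈-elsewhere⁺ n m

module SameKnowledge (κ : Config) (f : Address → Maybe AState) (I : Invariant κ)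
  (kn : ∀ X → knowledgeᵐ (f X) ≡ knowledgeAt κ X)
  (i→ : ∀ {X} → Internal κ X → Σ AState (λ s → f X ≡ just s))
  (i← : ∀ {X} → Σ AState (λ s → f X ≡ just s) → Internal κ X) where
  open Invariant I
  κ' : Config
  κ' = record κ { α = f }

  inUse↑ : ∀ {r} → InUse κ r → InUse κ' r
  inUse↑ (a , b , c) = a , b , λ i → c (i← i)

  ∈-same⁻ : ∀ {X φ} → φ ∈ knowledgeAt κ' X → φ ∈ knowledgeAt κ X
  ∈-same⁻ {X} m = subst (_ ∈_) (kn X) m
  ∈-same⁺ : ∀ {X φ} → φ ∈ knowledgeAt κ X → φ ∈ knowledgeAt κ' X
  ∈-same⁺ {X} m = subst (_ ∈_) (sym (kn X)) m

  transfer↑ : ∀ B → ChainTransfer κ κ' B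
  transfer↑ B = record
    { keeps-unreleased = λ u _ _ → u
    ; keeps-link = λ { _ _ (inj₁ m) → inj₁ (inj₁ (∈-same⁺ m)) ; _ _ (inj₂ m) → inj₁ (inj₂ m) }
    ; keeps-head = λ _ h → ∈-same⁺ h
    }

  localChain↑ : ∀ {x} → LocalChain κ x → LocalChain κ' x
  localChain↑ {x} c = LocalChain-transfer x (transfer↑ (target x)) c (last-unreleased (proj₂ (proj₂ c)))

  nothing→ : ∀ {A} → α κ A ≡ nothing → f A ≡ nothing
  nothing→ {A} e with f A in eq
  ... | nothing = refl
  ... | just s = ⊥-elim (nothing≢just (trans (sym e) (proj₂ (i← (s , eq)))))

  balance↑ : ∀ x → Balance κ x → Balance κ' x
  balance↑ x p rewrite kn (owner x) | kn (target x) = p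

  carried-once′ : ∀ x → CarriedOnce κ x → CarriedOnce κ' x
  carried-once′ x p rewrite kn (owner x) = p

  invariant : Invariant κ'
  invariant = record
    { internal-used = λ i → internal-used (i← i)
    ; external-absent = λ m → nothing→ (external-absent m)
    ; external-used = external-used
    ; receptionist-internal = λ m → i→ (receptionist-internal m)
    ; fact-inUse = λ {A} m r → inUse↑ (fact-inUse {A} (∈-same⁻ {A} m) r)
    ; msg-inUse = λ m r → inUse↑ (msg-inUse m r)
    ; created-inUse = created-inUse
    ; released-created = λ m → proj₁ (released-created m) , i→ (proj₂ (released-created m))
    ; app-wf = app-wf
    ; info-wf = λ m → proj₁ (info-wf m) , i→ (proj₂ (info-wf m))
    ; release-wf = λ m → let (a , b , c) = release-wf m in a , i→ b , c
    ; activated-wf = λ {A} m → activated-wf {A} (∈-same⁻ {A} m)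
    ; createdUsing-wf = λ {A} m → createdUsing-wf {A} (∈-same⁻ {A} m)
    ; released-recorded = λ {A} m → released-recorded {A} (∈-same⁻ {A} m)
    ; sent-consistent = λ {A} → subst Sent.Consistent (sym (kn A)) (sent-consistent {A})
    ; recv-consistent = λ {A} → subst Recv.Consistent (sym (kn A)) (recv-consistent {A})
    ; balanced = λ x i1 i2 nr → balance↑ x (balanced x (i← i1) (i← i2) nr)
    ; carried-once = λ x i1 → carried-once′ x (carried-once x (i← i1))
    ; chain-unrooted = λ x u i nρ → localChain↑ (chain-unrooted x u (i← i) nρ)
    ; chain-receptionist = λ m → let (y , a , b , c) = chain-receptionist m in y , a , b , localChain↑ c
    ; chain-exported = λ m e zR i → map₁ localChain↑ (chain-exported m (nothing← e) zR (i← i))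
    }
    where
    nothing← : ∀ {A} → f A ≡ nothing → α κ A ≡ nothing
    nothing← {A} e with α κ A in eq
    ... | nothing = refl
    ... | just s = ⊥-elim (nothing≢just (trans (sym e) (proj₂ (i→ (s , eq)))))

becomeIdle-preserves : ∀ {κ Φ} A → α κ A ≡ just (busy Φ) → Invariant κ → Invariant (record κ { α = upd (α κ) A (idle Φ) })
becomeIdle-preserves {κ} {Φ} A eq I = SameKnowledge.invariant κ f I (knowledge-agrees id (sym (knowledgeAt-≡ κ A eq))) i→ i←
  where open Update κ A (idle Φ) eq

inR-sound : ∀ x R → inR x R ≡ true → x ∈ R
inR-sound x (y ∷ R) e with x ==ᴿ y in eq
... | true = here (==ᴿ≡true⇒≡ x y eq)
... | false = there (inR-sound x R e)

inR-complete : ∀ x R → x ∈ R → inR x R ≡ true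
inR-complete x (y ∷ R) (here refl) rewrite ==ᴿ-refl x = refl
inR-complete x (y ∷ R) (there m) with x ==ᴿ y
... | true = refl
... | false = inR-complete x R m

inR-false : ∀ x R → x ∉ R → inR x R ≡ false
inR-false x R n with inR x R in eq
... | false = refl
... | true = ⊥-elim (n (inR-sound x R eq))

external⇒¬internal : ∀ {κ A} → α κ A ≡ nothing → ¬ Internal κ A
external⇒¬internal α≡nothing (_ , α≡just) with trans (sym α≡nothing) α≡just
... | ()

∉-map : ∀ {A : Set} {f : A → Fact} {φ} (R : List A) → (∀ a → φ ≢ f a) → φ ∉ map f R
∉-map R φ≢f m with ∈-map⁻ _ m
... | a , _ , φ≡fa = φ≢f a φ≡fa

SentFree-Activated : ∀ R → Sent.Free (map Activated R)
SentFree-Activated R = ∉-map R (λ _ ())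

RecvFree-Activated : ∀ R → Recv.Free (map Activated R)
RecvFree-Activated R = ∉-map R (λ _ ())

SentFree-CU : ∀ ps → Sent.Free (map CU ps)
SentFree-CU ps = ∉-map ps (λ { (_ , _) () })

RecvFree-CU : ∀ ps → Recv.Free (map CU ps)
RecvFree-CU ps = ∉-map ps (λ { (_ , _) () })

Activated∈map⁻ : ∀ {y} R → Activated y ∈ map Activated R → y ∈ R
Activated∈map⁻ R m with ∈-map⁻ Activated m
... | _ , y∈R , refl = y∈R

CreatedUsing∉map-Activated : ∀ {u v} R → CreatedUsing u v ∉ map Activated R
CreatedUsing∉map-Activated R = ∉-map R (λ _ ())

Released∉map-Activated : ∀ {u} R → Released u ∉ map Activated R
Released∉map-Activated R = ∉-map R (λ _ ())

module DropMessage (κ : Config) (I : Invariant κ) {e : Address × Msg} (p : e ∈ μ κ)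
  (not-sentAlong : ∀ x → Internal κ (target x) → sentAlong x e ≡ false)
  (not-carries : ∀ x → Internal κ (owner x) → carries x e ≡ false)
  (not-internal-Info : ∀ B y z B' → Internal κ B → e ≢ (B , Info y z B')) where
  open Invariant I
  κ' : Config
  κ' = record κ { μ = μ κ ─ p }

  ⊆ : ∀ {e'} → e' ∈ μ κ' → e' ∈ μ κ
  ⊆ m = ∈-─⁻ (μ κ) p m

  noRelease↑ : ∀ {x} → NoReleaseMsg κ x → NoReleaseMsg κ' x
  noRelease↑ h D n m = h D n (⊆ m)

  transfer↑ : ∀ B → Internal κ B → ChainTransfer κ κ' B
  transfer↑ B iB = record
    { keeps-unreleased = λ u _ _ → u
    ; keeps-link = λ { _ _ (inj₁ m) → inj₁ (inj₁ m) ; _ _ (inj₂ m) → inj₁ (inj₂ (∈-─⁺ (μ κ) p m (λ eq → not-internal-Info B _ _ _ iB (sym eq)))) }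
    ; keeps-head = λ _ h → h
    }

  localChain↑ : ∀ {x} → Internal κ (target x) → LocalChain κ x → LocalChain κ' x
  localChain↑ {x} i c = LocalChain-transfer x (transfer↑ (target x) i) c (last-unreleased (proj₂ (proj₂ c)))

  balance↑ : ∀ x → Internal κ (owner x) → Internal κ (target x) → Balance κ x → Balance κ' x
  balance↑ x _ i (inj₁ (h , eq)) = inj₁ (noRelease↑ h , trans eq (cong (_ +_) (sym (count-─-false (sentAlong x) (μ κ) p (not-sentAlong x i)))))
  balance↑ x io i (inj₂ (h , a , c , n0)) =
      inj₂ ( (λ D n m → trans (h D n (⊆ m)) (cong (_ +_) (sym (count-─-false (sentAlong x) (μ κ) p (not-sentAlong x i)))))
           , a
           , c
           , trans (count-─-false (carries x) (μ κ) p (not-carries x io)) n0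
           )

  invariant : Invariant κ'
  invariant = record
    { internal-used = internal-used
    ; external-absent = external-absent
    ; external-used = external-used
    ; receptionist-internal = receptionist-internal
    ; fact-inUse = fact-inUse
    ; msg-inUse = λ m r → msg-inUse (⊆ m) r
    ; created-inUse = created-inUse
    ; released-created = released-created
    ; app-wf = λ m → app-wf (⊆ m)
    ; info-wf = λ m → info-wf (⊆ m)
    ; release-wf = λ m → release-wf (⊆ m)
    ; activated-wf = λ m → let (a , b , c , d) = activated-wf m in a , b , c , noRelease↑ d
    ; createdUsing-wf = λ m → let (a , d) = createdUsing-wf m in a , noRelease↑ d
    ; released-recorded = released-recorded
    ; sent-consistent = sent-consistent
    ; recv-consistent = recv-consistent
    ; balanced = λ x i1 i2 nrl → balance↑ x i1 i2 (balanced x i1 i2 nrl)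
    ; carried-once = λ x i1 → carried-once′ x i1 (carried-once x i1)
    ; chain-unrooted = λ x u i nρ → localChain↑ i (chain-unrooted x u i nρ)
    ; chain-receptionist = λ m → let (y , a , b , c) = chain-receptionist m in y , a , b , localChain↑ (subst (Internal κ) (sym a) (receptionist-internal m)) c
    ; chain-exported = λ m en zR i → map₁ (localChain↑ i) (chain-exported (⊆ m) en zR i)
    }
    where
    carried-once′ : ∀ x → Internal κ (owner x) → CarriedOnce κ x → CarriedOnce κ' x
    carried-once′ x i (inj₁ z) = inj₁ (trans (count-─-false (carries x) (μ κ) p (not-carries x i)) z)
    carried-once′ x i (inj₂ (o , a , b , c)) = inj₂ (trans (count-─-false (carries x) (μ κ) p (not-carries x i)) o , a , noRelease↑ b , c)

module AddReceptionists (κ : Config) (I : Invariant κ) (new : List Address)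
  (new-receptionists : ∀ {A} → A ∈ new → Internal κ A × Σ Refob (λ y → target y ≡ A × owner y ∈ χ κ × LocalChain κ y)) where
  open Invariant I
  κ' : Config
  κ' = record κ { ρ = new ++ ρ κ }
  transfer↑ : ∀ B → ChainTransfer κ κ' B
  transfer↑ B = record { keeps-unreleased = λ u _ _ → u ; keeps-link = λ _ _ l → inj₁ l ; keeps-head = λ _ h → h }
  localChain↑ : ∀ {x} → LocalChain κ x → LocalChain κ' x
  localChain↑ {x} c = LocalChain-transfer x (transfer↑ (target x)) c (last-unreleased (proj₂ (proj₂ c)))
  invariant : Invariant κ'
  invariant = record
    { internal-used = internal-used ; external-absent = external-absent ; external-used = external-used
    ; receptionist-internal = λ {A} m → receptionist-internal′ {A} (∈-++⁻ new m)
    ; fact-inUse = fact-inUse ; msg-inUse = msg-inUse ; created-inUse = created-inUse ; released-created = released-created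
    ; app-wf = app-wf ; info-wf = info-wf ; release-wf = release-wf ; activated-wf = activated-wf ; createdUsing-wf = createdUsing-wf ; released-recorded = released-recorded
    ; sent-consistent = sent-consistent ; recv-consistent = recv-consistent ; balanced = balanced ; carried-once = carried-once
    ; chain-unrooted = λ x u i nρ → localChain↑ (chain-unrooted x u i (λ m → nρ (∈-++⁺ʳ new m)))
    ; chain-receptionist = λ {B} m → chain-receptionist′ {B} (∈-++⁻ new m)
    ; chain-exported = λ m en zR i → ⊎-map localChain↑ (∈-++⁺ʳ new) (chain-exported m en zR i)
    }
    where
    receptionist-internal′ : ∀ {A} → A ∈ new ⊎ A ∈ ρ κ → Internal κ A
    receptionist-internal′ (inj₁ m) = proj₁ (new-receptionists m)
    receptionist-internal′ (inj₂ m) = receptionist-internal m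
    chain-receptionist₀ : ∀ {B} → B ∈ new ⊎ B ∈ ρ κ → Σ Refob λ y → target y ≡ B × owner y ∈ χ κ × LocalChain κ y
    chain-receptionist₀ (inj₁ m) = proj₂ (new-receptionists m)
    chain-receptionist₀ (inj₂ m) = chain-receptionist m
    chain-receptionist′ : ∀ {B} → B ∈ new ⊎ B ∈ ρ κ → Σ Refob λ y → target y ≡ B × owner y ∈ χ κ × LocalChain κ' y
    chain-receptionist′ m = let (y , a , b , c) = chain-receptionist₀ m in y , a , b , localChain↑ c

releaseOut-preserves : ∀ {κ} x B n (p : (B , Release x n) ∈ μ κ) → Invariant κ → Invariant (record κ { μ = μ κ ─ p })
releaseOut-preserves {κ} x B n p I = DropMessage.invariant κ I p (λ _ _ → refl) (λ _ _ → refl) (λ _ _ _ _ _ ())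

infoOut-preserves : ∀ {κ} y z B C → C ∈ χ κ → (p : (C , Info y z B) ∈ μ κ) → Invariant κ → Invariant (record κ { μ = μ κ ─ p })
infoOut-preserves {κ} y z B C cχ p I = DropMessage.invariant κ I p hI (λ _ _ → refl) hF
  where
  open Invariant I
  hI : ∀ x → Internal κ (target x) → sentAlong x (C , Info y z B) ≡ false
  hI x i with x ≟ᴿ y
  ... | yes refl = ⊥-elim (external⇒¬internal {κ} (external-absent cχ) (subst (Internal κ) (proj₁ (info-wf p)) i))
  ... | no ne = ≢⇒==ᴿ≡false x y ne
  hF : ∀ B' y' z' B'' → Internal κ B' → (C , Info y z B) ≢ (B' , Info y' z' B'')
  hF B' y' z' B'' i refl = external⇒¬internal {κ} (external-absent cχ) i

outEv-preserves : ∀ {κ} x B R → B ∈ χ κ → (p : (B , App x R) ∈ μ κ) → Invariant κ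
  → Invariant (record κ { μ = μ κ ─ p ; ρ = filterᵇ (λ C → is-just (α κ C)) (map target R) ++ ρ κ })
outEv-preserves {κ} x B R bχ p I = DropMessage.invariant κ₁ invariant₁ p hI hA (λ _ _ _ _ _ ())
  where
  open Invariant I
  new : List Address
  new = filterᵇ (λ C → is-just (α κ C)) (map target R)
  new-receptionists : ∀ {A} → A ∈ new → Internal κ A × Σ Refob (λ y → target y ≡ A × owner y ∈ χ κ × LocalChain κ y)
  new-receptionists {A} m with ∈-filter⁻ (λ C → T? (is-just (α κ C))) {xs = map target R} m
  ... | m1 , t with ∈-map⁻ target m1
  ... | z , zR , refl = iA , w
    where
    iA : Internal κ (target z)
    iA with α κ (target z)
    ... | just s = s , refl
    w : Σ Refob (λ y → target y ≡ target z × owner y ∈ χ κ × LocalChain κ y)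
    w with chain-exported p (external-absent bχ) zR iA
    ... | inj₁ c = z , refl , subst (_∈ χ κ) (sym (proj₁ (proj₂ (app-wf p) zR))) bχ , c
    ... | inj₂ r = chain-receptionist r
  κ₁ : Config
  κ₁ = record κ { ρ = new ++ ρ κ }
  invariant₁ : Invariant κ₁
  invariant₁ = AddReceptionists.invariant κ I new new-receptionists
  hI : ∀ x' → Internal κ₁ (target x') → sentAlong x' (B , App x R) ≡ false
  hI x' i with x' ≟ᴿ x
  ... | yes refl = ⊥-elim (external⇒¬internal {κ} (external-absent bχ) (subst (Internal κ) (proj₁ (app-wf p)) i))
  ... | no ne = ≢⇒==ᴿ≡false x' x ne
  hA : ∀ x' → Internal κ₁ (owner x') → carries x' (B , App x R) ≡ false
  hA x' i = inR-false x' R (λ m → external⇒¬internal {κ} (external-absent bχ) (subst (Internal κ) (proj₁ (proj₂ (app-wf p) m)) i))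

receive-preserves : ∀ {κ Φ} x B R → (eq : α κ B ≡ just (idle Φ)) → (p : (B , App x R) ∈ μ κ) → Invariant κ
  → Invariant (record κ { α = upd (α κ) B (busy (IncRecv x Φ ++ map Activated R)) ; μ = μ κ ─ p })
receive-preserves {κ} {Φ} x B R eq p I = record
    { internal-used = λ i → internal-used (i← i)
    ; external-absent = λ m → nothing→ (external-absent m)
    ; external-used = external-used
    ; receptionist-internal = λ m → i→ (receptionist-internal m)
    ; fact-inUse = λ {X} → fact-inUse′ {X}
    ; msg-inUse = λ m r → inUse↑ (msg-inUse (⊆ m) r)
    ; created-inUse = created-inUse
    ; released-created = λ m → proj₁ (released-created m) , i→ (proj₂ (released-created m))
    ; app-wf = λ m → app-wf (⊆ m)
    ; info-wf = λ m → proj₁ (info-wf (⊆ m)) , i→ (proj₂ (info-wf (⊆ m)))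
    ; release-wf = λ m → let (a , b , c) = release-wf (⊆ m) in a , i→ b , c
    ; activated-wf = λ {X} → activated-wf′ {X}
    ; createdUsing-wf = λ {X} m → let (a , b) = createdUsing-wf {X} (createdUsing-old m) in a , noRelease↑ b
    ; released-recorded = λ {X} m → released-recorded {X} (released-old m)
    ; sent-consistent = λ {X} → all-knowledge Sent.Consistent sent-consistent-here sent-consistent {X}
    ; recv-consistent = λ {X} → all-knowledge Recv.Consistent recv-consistent-here recv-consistent {X}
    ; balanced = balanced′
    ; carried-once = carried-once′
    ; chain-unrooted = λ y u i nρ → localChain↑ (chain-unrooted y u (i← i) nρ)
    ; chain-receptionist = λ m → let (y , a , b , c) = chain-receptionist m in y , a , b , localChain↑ c
    ; chain-exported = λ m en zR i → map₁ localChain↑ (chain-exported (⊆ m) (nothing← en) zR (i← i))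
    }
  where
  open Invariant I
  Φ' : Knowledge
  Φ' = IncRecv x Φ ++ map Activated R
  open Update κ B (busy Φ') eq
  κ' : Config
  κ' = record κ { α = f ; μ = μ κ ─ p }
  ⊆ : ∀ {e'} → e' ∈ μ κ' → e' ∈ μ κ
  ⊆ m = ∈-─⁻ (μ κ) p m
  knowledge≡Φ : knowledgeAt κ B ≡ Φ
  knowledge≡Φ = knowledgeAt-≡ κ B eq
  tx : target x ≡ B
  tx = proj₁ (app-wf p)
  fromΦ : ∀ {φ} → φ ∈ Φ → φ ∈ knowledgeAt κ B
  fromΦ m = subst (_ ∈_) (sym knowledge≡Φ) m
  inUse↑ : ∀ {r} → InUse κ r → InUse κ' r
  inUse↑ (a , b , c) = a , b , λ i → c (i← i)
  noRelease↑ : ∀ {y} → NoReleaseMsg κ y → NoReleaseMsg κ' y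
  noRelease↑ h D n m = h D n (⊆ m)

  fact-inUse′ : ∀ {X φ r} → φ ∈ knowledgeᵐ (f X) → r ∈ factRefobs φ → InUse κ' r
  fact-inUse′ {X} m r with ∈-updated⁻ {X} m
  ... | inj₂ (_ , m') = inUse↑ (fact-inUse m' r)
  ... | inj₁ (refl , m') with ∈-++⁻ (IncRecv x Φ) m'
  ... | inj₁ (here refl) = inUse↑ (msg-inUse p (subst (_∈ msgRefobs (App x R)) (sym (single r)) (here refl)))
    where single : ∀ {r} → r ∈ x ∷ [] → r ≡ x
          single (here e) = e
  ... | inj₁ (there d) = inUse↑ (fact-inUse (fromΦ (∈-discard⁻ Φ d)) r)
  ... | inj₂ d with ∈-map⁻ Activated d
  fact-inUse′ {X} m (here refl) | inj₁ (refl , m') | inj₂ d | z , zR , refl = inUse↑ (msg-inUse p (there zR))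

  activated-old⊎received : ∀ {y X} → Activated y ∈ knowledgeᵐ (f X) → (Activated y ∈ knowledgeAt κ X) ⊎ (X ≡ B × y ∈ R)
  activated-old⊎received {y} {X} m with ∈-updated⁻ {X} m
  ... | inj₂ (_ , m') = inj₁ m'
  ... | inj₁ (refl , m') with ∈-++⁻ (IncRecv x Φ) m'
  ... | inj₁ (here ())
  ... | inj₁ (there d) = inj₁ (fromΦ (∈-discard⁻ Φ d))
  ... | inj₂ d = inj₂ (refl , Activated∈map⁻ R d)

  createdUsing-old : ∀ {u v X} → CreatedUsing u v ∈ knowledgeᵐ (f X) → CreatedUsing u v ∈ knowledgeAt κ X
  createdUsing-old {u} {v} {X} m with ∈-updated⁻ {X} m
  ... | inj₂ (_ , m') = m'
  ... | inj₁ (refl , m') with ∈-++⁻ (IncRecv x Φ) m'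
  ... | inj₁ (here ())
  ... | inj₁ (there d) = fromΦ (∈-discard⁻ Φ d)
  ... | inj₂ d = ⊥-elim (CreatedUsing∉map-Activated R d)

  released-old : ∀ {u X} → Released u ∈ knowledgeᵐ (f X) → Released u ∈ knowledgeAt κ X
  released-old {u} {X} m with ∈-updated⁻ {X} m
  ... | inj₂ (_ , m') = m'
  ... | inj₁ (refl , m') with ∈-++⁻ (IncRecv x Φ) m'
  ... | inj₁ (here ())
  ... | inj₁ (there d) = fromΦ (∈-discard⁻ Φ d)
  ... | inj₂ d = ⊥-elim (Released∉map-Activated R d)

  carried⇒carriers≢0 : ∀ {y} → y ∈ R → ∀ {k} → carriers y (μ κ) ≡ k → k ≢ 0
  carried⇒carriers≢0 {y} yR e k0 with count≡suc (carries y) (μ κ) p (inR-complete _ R yR)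
  ... | k , c = 1+n≢0 (trans (sym c) (trans e k0))

  activated-wf′ : ∀ {X y} → Activated y ∈ knowledgeᵐ (f X) → owner y ≡ X × y ∈ created κ' × y ∉ released κ' × NoReleaseMsg κ' y
  activated-wf′ {X} {y} m with activated-old⊎received m
  ... | inj₁ m' = let (a , b , c , d) = activated-wf {X} m' in a , b , c , noRelease↑ d
  ... | inj₂ (refl , yR) with app-wf p
  ... | _ , hR with hR yR
  ... | oy , cy with carried-once y (subst (Internal κ) (sym oy) (_ , eq))
  ... | inj₁ z = ⊥-elim (carried⇒carriers≢0 yR z refl)
  ... | inj₂ (_ , _ , nr , nrel) = oy , cy , nrel , noRelease↑ nr

  sentOf-same : ∀ y X → sentOf y (knowledgeᵐ (f X)) ≡ sentOf y (knowledgeAt κ X)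
  sentOf-same y = knowledge-agrees (sentOf y) (trans (Sent.countOf-++ y (IncRecv x Φ) (map Activated R) (SentFree-Activated R))
                       (trans (Sent.countOf-discard (isRecvOf x) y Φ (λ _ → refl)) (cong (sentOf y) (sym knowledge≡Φ))))

  recvOf-same-≢ : ∀ y → y ≢ x → ∀ X → recvOf y (knowledgeᵐ (f X)) ≡ recvOf y (knowledgeAt κ X)
  recvOf-same-≢ y ne = knowledge-agrees (recvOf y) (trans (Recv.countOf-++ y (IncRecv x Φ) (map Activated R) (RecvFree-Activated R))
                       (trans (Recv.countOf-Inc-≢ y x Φ ne) (cong (recvOf y) (sym knowledge≡Φ))))

  recvOf-inc : recvOf x (knowledgeᵐ (f (target x))) ≡ suc (recvOf x (knowledgeAt κ (target x)))
  recvOf-inc rewrite tx | knowledge-here | knowledge≡Φ = trans (Recv.countOf-++ x (IncRecv x Φ) (map Activated R) (RecvFree-Activated R)) (Recv.countOf-Inc x Φ)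

  activated∉↑ : ∀ {y} → Activated y ∉ knowledgeAt κ (owner y) → carriers y (μ κ) ≡ 0 → Activated y ∉ knowledgeᵐ (f (owner y))
  activated∉↑ a n0 m with activated-old⊎received m
  ... | inj₁ m' = a m'
  ... | inj₂ (_ , yR) = carried⇒carriers≢0 yR n0 refl

  carriers≡0↑ : ∀ {y} → carriers y (μ κ) ≡ 0 → carriers y (μ κ') ≡ 0
  carriers≡0↑ {y} = count-─≡0 (carries y) (μ κ) p

  balanced′ : ∀ y → Internal κ' (owner y) → Internal κ' (target y) → y ∉ released κ' → Balance κ' y
  balanced′ y io it nrel with balanced y (i← io) (i← it) nrel | y ≟ᴿ x
  ... | inj₁ (nr , e0) | yes refl = inj₁ (noRelease↑ nr , balance-eq)
    where
    inFlight≡ : inFlight x (μ κ) ≡ suc (inFlight x (μ κ'))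
    inFlight≡ = count-─-true (sentAlong x) (μ κ) p (==ᴿ-refl x)
    balance-eq : sentOf x (knowledgeᵐ (f (owner x))) ≡ recvOf x (knowledgeᵐ (f (target x))) + inFlight x (μ κ')
    balance-eq = trans (sentOf-same x (owner x)) (trans e0 (trans (cong (recvOf x (knowledgeAt κ (target x)) +_) inFlight≡)
              (trans (+-suc _ _) (cong (_+ inFlight x (μ κ')) (sym recvOf-inc)))))
  ... | inj₂ (h , a , c , n0) | yes refl = inj₂ (release-count′ , activated∉↑ a n0 , (λ v m → c v (createdUsing-old m)) , carriers≡0↑ n0)
    where
    inFlight≡ : inFlight x (μ κ) ≡ suc (inFlight x (μ κ'))
    inFlight≡ = count-─-true (sentAlong x) (μ κ) p (==ᴿ-refl x)
    release-count′ : ∀ D n → (D , Release x n) ∈ μ κ' → n ≡ recvOf x (knowledgeᵐ (f (target x))) + inFlight x (μ κ')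
    release-count′ D n m = trans (h D n (⊆ m)) (trans (cong (recvOf x (knowledgeAt κ (target x)) +_) inFlight≡)
              (trans (+-suc _ _) (cong (_+ inFlight x (μ κ')) (sym recvOf-inc))))
  ... | inj₁ (nr , e0) | no ne =
      inj₁ ( noRelease↑ nr
           , trans (sentOf-same y (owner y)) (trans e0 (cong₂ _+_ (sym (recvOf-same-≢ y ne (target y))) (sym inFlight≡)))
           )
    where
    inFlight≡ : inFlight y (μ κ') ≡ inFlight y (μ κ)
    inFlight≡ = count-─-false (sentAlong y) (μ κ) p (≢⇒==ᴿ≡false y x ne)
  ... | inj₂ (h , a , c , n0) | no ne =
      inj₂ ( (λ D n m → trans (h D n (⊆ m)) (cong₂ _+_ (sym (recvOf-same-≢ y ne (target y))) (sym inFlight≡)))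
           , activated∉↑ a n0
           , (λ v m → c v (createdUsing-old m))
           , carriers≡0↑ n0
           )
    where
    inFlight≡ : inFlight y (μ κ') ≡ inFlight y (μ κ)
    inFlight≡ = count-─-false (sentAlong y) (μ κ) p (≢⇒==ᴿ≡false y x ne)

  carried-once′ : ∀ y → Internal κ' (owner y) → CarriedOnce κ' y
  carried-once′ y io with carried-once y (i← io) | inR y R in eqR
  ... | inj₁ z | true = ⊥-elim (carried⇒carriers≢0 (inR-sound y R eqR) z refl)
  ... | inj₂ (o , _) | true = inj₁ (suc-injective (trans (sym (count-─-true (carries y) (μ κ) p eqR)) o))
  ... | inj₁ z | false = inj₁ (trans (count-─-false (carries y) (μ κ) p eqR) z)
  ... | inj₂ (o , a , nr , nrel) | false = inj₂ (trans (count-─-false (carries y) (μ κ) p eqR) o , not-activated′ , noRelease↑ nr , nrel)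
    where
    not-activated′ : Activated y ∉ knowledgeᵐ (f (owner y))
    not-activated′ m with activated-old⊎received m
    ... | inj₁ m' = a m'
    ... | inj₂ (_ , yR) = true≢false (trans (sym (inR-complete y R yR)) eqR)

  kept∈ : ∀ {φ} → isRecvOf x φ ≡ false → ∀ {X} → φ ∈ knowledgeAt κ X → φ ∈ knowledgeᵐ (f X)
  kept∈ pf = kept∈-from (λ m → ∈-++⁺ˡ (there (∈-discard⁺ Φ (subst (_ ∈_) knowledge≡Φ m) pf)))

  transfer↑ : ∀ B' → ChainTransfer κ κ' B'
  transfer↑ B' = record
    { keeps-unreleased = λ u _ _ → u
    ; keeps-link = λ { _ _ (inj₁ m) → inj₁ (inj₁ (kept∈ refl m)) ; _ _ (inj₂ m) → inj₁ (inj₂ (∈-─⁺ (μ κ) p m (λ ()))) }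
    ; keeps-head = λ _ h → kept∈ refl h }

  localChain↑ : ∀ {y} → LocalChain κ y → LocalChain κ' y
  localChain↑ {y} c = LocalChain-transfer y (transfer↑ (target y)) c (last-unreleased (proj₂ (proj₂ c)))

  sent-consistent-here : Sent.Consistent Φ'
  sent-consistent-here =
    Sent.Consistent-++ (IncRecv x Φ) (map Activated R) (SentFree-Activated R)
      (Sent.Consistent-∷ _ _ (λ ())
        (Sent.Consistent-discard (isRecvOf x) Φ (λ _ _ _ → refl)
          (subst Sent.Consistent knowledge≡Φ (sent-consistent {B}))))
  recv-consistent-here : Recv.Consistent Φ'
  recv-consistent-here =
    Recv.Consistent-++ (IncRecv x Φ) (map Activated R) (RecvFree-Activated R)
      (Recv.Consistent-Inc x Φ
        (subst Recv.Consistent knowledge≡Φ (recv-consistent {B})))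

info-preserves : ∀ {κ Φ} y z B C → (eq : α κ C ≡ just (idle Φ)) → (p : (C , Info y z B) ∈ μ κ) → Invariant κ
  → Invariant (record κ { α = upd (α κ) C (idle (Created z ∷ IncRecv y Φ)) ; μ = μ κ ─ p })
info-preserves {κ} {Φ} y z B C eq p I = record
    { internal-used = λ i → internal-used (i← i)
    ; external-absent = λ m → nothing→ (external-absent m)
    ; external-used = external-used
    ; receptionist-internal = λ m → i→ (receptionist-internal m)
    ; fact-inUse = λ {X} → fact-inUse′ {X}
    ; msg-inUse = λ m r → inUse↑ (msg-inUse (⊆ m) r)
    ; created-inUse = created-inUse
    ; released-created = λ m → proj₁ (released-created m) , i→ (proj₂ (released-created m))
    ; app-wf = λ m → app-wf (⊆ m)
    ; info-wf = λ m → proj₁ (info-wf (⊆ m)) , i→ (proj₂ (info-wf (⊆ m)))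
    ; release-wf = λ m → let (a , b , c) = release-wf (⊆ m) in a , i→ b , c
    ; activated-wf = λ {X} m → let (a , b , c , d) = activated-wf {X} (activated-old {_} {X} m) in a , b , c , noRelease↑ d
    ; createdUsing-wf = λ {X} m → let (a , b) = createdUsing-wf {X} (createdUsing-old m) in a , noRelease↑ b
    ; released-recorded = λ {X} m → released-recorded {X} (released-old m)
    ; sent-consistent = λ {X} → all-knowledge Sent.Consistent sent-consistent-here sent-consistent {X}
    ; recv-consistent = λ {X} → all-knowledge Recv.Consistent recv-consistent-here recv-consistent {X}
    ; balanced = balanced′
    ; carried-once = carried-once′
    ; chain-unrooted = λ w u i nρ → localChain↑ w (chain-unrooted w u (i← i) nρ) u
    ; chain-receptionist = λ m → let (w , a , b , c) = chain-receptionist m in w , a , b , localChain↑ w c (last-unreleased (proj₂ (proj₂ c)))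
    ; chain-exported = λ m en zR i → map₁ (λ c → localChain↑ _ c (last-unreleased (proj₂ (proj₂ c)))) (chain-exported (⊆ m) (nothing← en) zR (i← i))
    }
  where
  open Invariant I
  Φ' : Knowledge
  Φ' = Created z ∷ IncRecv y Φ
  open Update κ C (idle Φ') eq
  κ' : Config
  κ' = record κ { α = f ; μ = μ κ ─ p }
  ⊆ : ∀ {e'} → e' ∈ μ κ' → e' ∈ μ κ
  ⊆ m = ∈-─⁻ (μ κ) p m
  knowledge≡Φ : knowledgeAt κ C ≡ Φ
  knowledge≡Φ = knowledgeAt-≡ κ C eq
  ty : target y ≡ C
  ty = proj₁ (info-wf p)
  fromΦ : ∀ {φ} → φ ∈ Φ → φ ∈ knowledgeAt κ C
  fromΦ m = subst (_ ∈_) (sym knowledge≡Φ) m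
  inUse↑ : ∀ {r} → InUse κ r → InUse κ' r
  inUse↑ (a , b , c) = a , b , λ i → c (i← i)
  noRelease↑ : ∀ {w} → NoReleaseMsg κ w → NoReleaseMsg κ' w
  noRelease↑ h D n m = h D n (⊆ m)

  fact-inUse′ : ∀ {X φ r} → φ ∈ knowledgeᵐ (f X) → r ∈ factRefobs φ → InUse κ' r
  fact-inUse′ {X} m r with ∈-updated⁻ {X} m
  ... | inj₂ (_ , m') = inUse↑ (fact-inUse m' r)
  fact-inUse′ {X} m (here refl) | inj₁ (refl , here refl) = inUse↑ (msg-inUse p (there (here refl)))
  fact-inUse′ {X} m (here refl) | inj₁ (refl , there (here refl)) = inUse↑ (msg-inUse p (here refl))
  ... | inj₁ (refl , there (there d)) = inUse↑ (fact-inUse (fromΦ (∈-discard⁻ Φ d)) r)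

  activated-old : ∀ {w X} → Activated w ∈ knowledgeᵐ (f X) → Activated w ∈ knowledgeAt κ X
  activated-old {w} {X} m with ∈-updated⁻ {X} m
  ... | inj₂ (_ , m') = m'
  ... | inj₁ (refl , there (there d)) = fromΦ (∈-discard⁻ Φ d)

  createdUsing-old : ∀ {u v X} → CreatedUsing u v ∈ knowledgeᵐ (f X) → CreatedUsing u v ∈ knowledgeAt κ X
  createdUsing-old {u} {v} {X} m with ∈-updated⁻ {X} m
  ... | inj₂ (_ , m') = m'
  ... | inj₁ (refl , there (there d)) = fromΦ (∈-discard⁻ Φ d)

  released-old : ∀ {u X} → Released u ∈ knowledgeᵐ (f X) → Released u ∈ knowledgeAt κ X
  released-old {u} {X} m with ∈-updated⁻ {X} m
  ... | inj₂ (_ , m') = m'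
  ... | inj₁ (refl , there (there d)) = fromΦ (∈-discard⁻ Φ d)

  sentOf-same : ∀ w X → sentOf w (knowledgeᵐ (f X)) ≡ sentOf w (knowledgeAt κ X)
  sentOf-same w = knowledge-agrees (sentOf w) (trans (Sent.countOf-discard (isRecvOf y) w Φ (λ _ → refl)) (cong (sentOf w) (sym knowledge≡Φ)))

  recvOf-same-≢ : ∀ w → w ≢ y → ∀ X → recvOf w (knowledgeᵐ (f X)) ≡ recvOf w (knowledgeAt κ X)
  recvOf-same-≢ w ne = knowledge-agrees (recvOf w) (trans (Recv.countOf-Inc-≢ w y Φ ne) (cong (recvOf w) (sym knowledge≡Φ)))

  recvOf-inc : recvOf y (knowledgeᵐ (f (target y))) ≡ suc (recvOf y (knowledgeAt κ (target y)))
  recvOf-inc rewrite ty | knowledge-here | knowledge≡Φ = Recv.countOf-Inc y Φ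

  carriers-same : ∀ w → carriers w (μ κ') ≡ carriers w (μ κ)
  carriers-same w = count-─-false (carries w) (μ κ) p refl

  balanced′ : ∀ w → Internal κ' (owner w) → Internal κ' (target w) → w ∉ released κ' → Balance κ' w
  balanced′ w io it nrel with balanced w (i← io) (i← it) nrel | w ≟ᴿ y
  ... | inj₁ (nr , e0) | yes refl = inj₁ (noRelease↑ nr , balance-eq)
    where
    inFlight≡ : inFlight y (μ κ) ≡ suc (inFlight y (μ κ'))
    inFlight≡ = count-─-true (sentAlong y) (μ κ) p (==ᴿ-refl y)
    balance-eq : sentOf y (knowledgeᵐ (f (owner y))) ≡ recvOf y (knowledgeᵐ (f (target y))) + inFlight y (μ κ')
    balance-eq = trans (sentOf-same y (owner y)) (trans e0 (trans (cong (recvOf y (knowledgeAt κ (target y)) +_) inFlight≡)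
              (trans (+-suc _ _) (cong (_+ inFlight y (μ κ')) (sym recvOf-inc)))))
  ... | inj₂ (h , a , c , n0) | yes refl = inj₂ (release-count′ , (λ m → a (activated-old m)) , (λ v m → c v (createdUsing-old m)) , trans (carriers-same y) n0)
    where
    inFlight≡ : inFlight y (μ κ) ≡ suc (inFlight y (μ κ'))
    inFlight≡ = count-─-true (sentAlong y) (μ κ) p (==ᴿ-refl y)
    release-count′ : ∀ D n → (D , Release y n) ∈ μ κ' → n ≡ recvOf y (knowledgeᵐ (f (target y))) + inFlight y (μ κ')
    release-count′ D n m = trans (h D n (⊆ m)) (trans (cong (recvOf y (knowledgeAt κ (target y)) +_) inFlight≡)
              (trans (+-suc _ _) (cong (_+ inFlight y (μ κ')) (sym recvOf-inc))))
  ... | inj₁ (nr , e0) | no ne =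
      inj₁ ( noRelease↑ nr
           , trans (sentOf-same w (owner w)) (trans e0 (cong₂ _+_ (sym (recvOf-same-≢ w ne (target w))) (sym inFlight≡)))
           )
    where
    inFlight≡ : inFlight w (μ κ') ≡ inFlight w (μ κ)
    inFlight≡ = count-─-false (sentAlong w) (μ κ) p (≢⇒==ᴿ≡false w y ne)
  ... | inj₂ (h , a , c , n0) | no ne =
      inj₂ ( (λ D n m → trans (h D n (⊆ m)) (cong₂ _+_ (sym (recvOf-same-≢ w ne (target w))) (sym inFlight≡)))
           , (λ m → a (activated-old m))
           , (λ v m → c v (createdUsing-old m))
           , trans (carriers-same w) n0
           )
    where
    inFlight≡ : inFlight w (μ κ') ≡ inFlight w (μ κ)
    inFlight≡ = count-─-false (sentAlong w) (μ κ) p (≢⇒==ᴿ≡false w y ne)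

  carried-once′ : ∀ w → Internal κ' (owner w) → CarriedOnce κ' w
  carried-once′ w io with carried-once w (i← io)
  ... | inj₁ z = inj₁ (trans (carriers-same w) z)
  ... | inj₂ (o , a , nr , nrel) = inj₂ (trans (carriers-same w) o , (λ m → a (activated-old m)) , noRelease↑ nr , nrel)

  kept∈ : ∀ {φ} → isRecvOf y φ ≡ false → ∀ {X} → φ ∈ knowledgeAt κ X → φ ∈ knowledgeᵐ (f X)
  kept∈ pf = kept∈-from (λ m → there (there (∈-discard⁺ Φ (subst (_ ∈_) knowledge≡Φ m) pf)))

  transfer↑ : ∀ B' → ChainTransfer κ κ' B'
  transfer↑ B' = record
    { keeps-unreleased = λ u _ _ → u
    ; keeps-link = keeps-link′
    ; keeps-head = λ _ h → kept∈ refl h }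
    where
    keeps-link′ : ∀ {xi xj} → Unreleased? κ xi → target xi ≡ B' → LinkIn κ B' xi xj → LinkIn κ' B' xi xj ⊎ Created xj ∈ knowledgeᵐ (f B')
    keeps-link′ _ _ (inj₁ m) = inj₁ (inj₁ (kept∈ refl m))
    keeps-link′ {xi} {xj} _ _ (inj₂ m) with xj ≟ᴿ z | B' ≟ C
    ... | yes refl | yes refl = inj₂ (∈-here⁺ (here refl))
    ... | no n | _ = inj₁ (inj₂ (∈-─⁺ (μ κ) p m (λ { refl → n refl })))
    ... | yes _ | no n = inj₁ (inj₂ (∈-─⁺ (μ κ) p m (λ { refl → n refl })))

  localChain↑ : ∀ w → LocalChain κ w → Unreleased? κ' w → LocalChain κ' w
  localChain↑ w c u = LocalChain-transfer w (transfer↑ (target w)) c u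

  sent-consistent-here : Sent.Consistent Φ'
  sent-consistent-here =
    Sent.Consistent-∷ _ _ (λ ())
      (Sent.Consistent-∷ _ _ (λ ())
        (Sent.Consistent-discard (isRecvOf y) Φ (λ _ _ _ → refl)
          (subst Sent.Consistent knowledge≡Φ (sent-consistent {C}))))
  recv-consistent-here : Recv.Consistent Φ'
  recv-consistent-here =
    Recv.Consistent-∷ _ _ (λ ())
      (Recv.Consistent-Inc y Φ
        (subst Recv.Consistent knowledge≡Φ (recv-consistent {C})))

release-preserves : ∀ {κ Φ} x B n → (eq : α κ B ≡ just (idle Φ)) → (p : (B , Release x n) ∈ μ κ) → Φ ⊢ RecvCount x n → Invariant κ
  → Invariant (record κ { α = upd (α κ) B (idle (Released x ∷ Φ)) ; μ = μ κ ─ p ; released = x ∷ released κ })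
release-preserves {κ} {Φ} x B n eq p d I = record
    { internal-used = λ i → internal-used (i← i)
    ; external-absent = λ m → nothing→ (external-absent m)
    ; external-used = external-used
    ; receptionist-internal = λ m → i→ (receptionist-internal m)
    ; fact-inUse = λ {X} → fact-inUse′ {X}
    ; msg-inUse = λ m r → inUse↑ (msg-inUse (⊆ m) r)
    ; created-inUse = created-inUse
    ; released-created = released-created′
    ; app-wf = λ m → app-wf (⊆ m)
    ; info-wf = λ m → proj₁ (info-wf (⊆ m)) , i→ (proj₂ (info-wf (⊆ m)))
    ; release-wf = λ m → let (a , b , c) = release-wf (⊆ m) in a , i→ b , c
    ; activated-wf = λ {X} m → let (a , b , c , d) = activated-wf {X} (activated-old {_} {X} m) in a , b , not-released↑ c d , noRelease↑ d
    ; createdUsing-wf = λ {X} m → let (a , b) = createdUsing-wf {X} (createdUsing-old m) in a , noRelease↑ b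
    ; released-recorded = λ {X} → released-recorded′ {X}
    ; sent-consistent = λ {X} → all-knowledge Sent.Consistent sent-consistent-here sent-consistent {X}
    ; recv-consistent = λ {X} → all-knowledge Recv.Consistent recv-consistent-here recv-consistent {X}
    ; balanced = balanced′
    ; carried-once = carried-once′
    ; chain-unrooted = λ w u i nρ → localChain↑ w (chain-unrooted w (proj₁ u , λ m → proj₂ u (there m)) (i← i) nρ) u
    ; chain-receptionist = λ m → let (w , a , b , c) = chain-receptionist m in w , a , b , localChain↑ w c (external-owner-unreleased↑ b (last-unreleased (proj₂ (proj₂ c))))
    ; chain-exported = λ {C'} m en zR i → map₁ (λ c → localChain↑ _ c (exported-unreleased↑ (⊆ m) (nothing← en) zR (last-unreleased (proj₂ (proj₂ c))))) (chain-exported (⊆ m) (nothing← en) zR (i← i))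
    }
  where
  open Invariant I
  open Update κ B (idle (Released x ∷ Φ)) eq
  κ' : Config
  κ' = record κ { α = f ; μ = μ κ ─ p ; released = x ∷ released κ }
  ⊆ : ∀ {e'} → e' ∈ μ κ' → e' ∈ μ κ
  ⊆ m = ∈-─⁻ (μ κ) p m
  knowledge≡Φ : knowledgeAt κ B ≡ Φ
  knowledge≡Φ = knowledgeAt-≡ κ B eq
  tx : target x ≡ B
  tx = proj₁ (release-wf p)
  ox : Internal κ (owner x)
  ox = proj₁ (proj₂ (release-wf p))
  fromΦ : ∀ {φ} → φ ∈ Φ → φ ∈ knowledgeAt κ B
  fromΦ m = subst (_ ∈_) (sym knowledge≡Φ) m
  inUse↑ : ∀ {r} → InUse κ r → InUse κ' r
  inUse↑ (a , b , c) = a , b , λ i → c (i← i)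
  noRelease↑ : ∀ {w} → NoReleaseMsg κ w → NoReleaseMsg κ' w
  noRelease↑ h D n m = h D n (⊆ m)
  noReleaseMsg⇒≢x : ∀ {w} → NoReleaseMsg κ w → w ≢ x
  noReleaseMsg⇒≢x h refl = h B n p
  not-released↑ : ∀ {w} → w ∉ released κ → NoReleaseMsg κ w → w ∉ released κ'
  not-released↑ a h (here refl) = noReleaseMsg⇒≢x h refl
  not-released↑ a h (there m) = a m
  released-created′ : ∀ {r} → r ∈ released κ' → r ∈ created κ' × Internal κ' (owner r)
  released-created′ (here refl) = proj₂ (proj₂ (release-wf p)) , i→ ox
  released-created′ (there m) = proj₁ (released-created m) , i→ (proj₂ (released-created m))
  external-owner-unreleased↑ : ∀ {w} → owner w ∈ χ κ → Unreleased? κ w → Unreleased? κ' w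
  external-owner-unreleased↑ {w} oχ (c , u) = c , λ { (here refl) → external⇒¬internal {κ} (external-absent oχ) ox ; (there m) → u m }
  exported-unreleased↑ : ∀ {C' x' R w} → (C' , App x' R) ∈ μ κ → α κ C' ≡ nothing → w ∈ R → Unreleased? κ w → Unreleased? κ' w
  exported-unreleased↑ m en wR (c , u) = c , λ { (here refl) → external⇒¬internal {κ} en (subst (Internal κ) (proj₁ (proj₂ (app-wf m) wR)) ox) ; (there m') → u m' }

  fact-inUse′ : ∀ {X φ r} → φ ∈ knowledgeᵐ (f X) → r ∈ factRefobs φ → InUse κ' r
  fact-inUse′ {X} m r with ∈-updated⁻ {X} m
  ... | inj₂ (_ , m') = inUse↑ (fact-inUse m' r)
  fact-inUse′ {X} m (here refl) | inj₁ (refl , here refl) = inUse↑ (msg-inUse p (here refl))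
  ... | inj₁ (refl , there d) = inUse↑ (fact-inUse (fromΦ d) r)

  activated-old : ∀ {w X} → Activated w ∈ knowledgeᵐ (f X) → Activated w ∈ knowledgeAt κ X
  activated-old {w} {X} m with ∈-updated⁻ {X} m
  ... | inj₂ (_ , m') = m'
  ... | inj₁ (refl , there d) = fromΦ d

  createdUsing-old : ∀ {u v X} → CreatedUsing u v ∈ knowledgeᵐ (f X) → CreatedUsing u v ∈ knowledgeAt κ X
  createdUsing-old {u} {v} {X} m with ∈-updated⁻ {X} m
  ... | inj₂ (_ , m') = m'
  ... | inj₁ (refl , there d) = fromΦ d

  released-recorded′ : ∀ {X u} → Released u ∈ knowledgeᵐ (f X) → u ∈ released κ'
  released-recorded′ {X} m with ∈-updated⁻ {X} m
  ... | inj₂ (_ , m') = there (released-recorded m')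
  ... | inj₁ (refl , here refl) = here refl
  ... | inj₁ (refl , there d) = there (released-recorded (fromΦ d))

  sentOf-same : ∀ w X → sentOf w (knowledgeᵐ (f X)) ≡ sentOf w (knowledgeAt κ X)
  sentOf-same w = knowledge-agrees (sentOf w) (cong (sentOf w) (sym knowledge≡Φ))
  recvOf-same : ∀ w X → recvOf w (knowledgeᵐ (f X)) ≡ recvOf w (knowledgeAt κ X)
  recvOf-same w = knowledge-agrees (recvOf w) (cong (recvOf w) (sym knowledge≡Φ))
  carriers-same : ∀ w → carriers w (μ κ') ≡ carriers w (μ κ)
  carriers-same w = count-─-false (carries w) (μ κ) p refl
  inFlight-same : ∀ w → inFlight w (μ κ') ≡ inFlight w (μ κ)
  inFlight-same w = count-─-false (sentAlong w) (μ κ) p refl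

  balanced′ : ∀ w → Internal κ' (owner w) → Internal κ' (target w) → w ∉ released κ' → Balance κ' w
  balanced′ w io it nrel with balanced w (i← io) (i← it) (λ m → nrel (there m))
  ... | inj₁ (nr , e0) =
      inj₁ ( noRelease↑ nr
           , trans (sentOf-same w (owner w)) (trans e0 (cong₂ _+_ (sym (recvOf-same w (target w))) (sym (inFlight-same w))))
           )
  ... | inj₂ (h , a , c , n0) =
      inj₂ ( (λ D n m → trans (h D n (⊆ m)) (cong₂ _+_ (sym (recvOf-same w (target w))) (sym (inFlight-same w))))
           , (λ m → a (activated-old m))
           , (λ v m → c v (createdUsing-old m))
           , trans (carriers-same w) n0
           )

  carried-once′ : ∀ w → Internal κ' (owner w) → CarriedOnce κ' w
  carried-once′ w io with carried-once w (i← io)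
  ... | inj₁ z = inj₁ (trans (carriers-same w) z)
  ... | inj₂ (o , a , nr , nrel) = inj₂ (trans (carriers-same w) o , (λ m → a (activated-old m)) , noRelease↑ nr , not-released↑ nrel nr)

  -- The Release count is recvOf x plus what is in flight along x, and it equals recvOf x,
  -- so no Info along x is in flight; its owner has dropped every CreatedUsing(x, _).
  released-has-no-successor : ∀ {B' xj} → Unreleased? κ x → LinkIn κ B' x xj → ⊥
  released-has-no-successor u l with balanced x ox (subst (Internal κ) (sym tx) (_ , eq)) (proj₂ u)
  ... | inj₁ (no-release , _) = no-release B n p
  released-has-no-successor u (inj₁ m) | inj₂ (_ , _ , no-cu , _) = no-cu _ m
  released-has-no-successor u (inj₂ m) | inj₂ (release-count , _) with count≡suc (sentAlong x) (μ κ) m (==ᴿ-refl x)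
  ... | k , inFlight≡1+k = m+1+n≢m (recvOf x Φ) (sym (begin
    recvOf x Φ                                         ≡⟨ ⊢RecvCount⇒recvOf Φ (subst Recv.Consistent knowledge≡Φ (recv-consistent {B})) d ⟨
    n                                                  ≡⟨ release-count B n p ⟩
    recvOf x (knowledgeAt κ (target x)) + inFlight x (μ κ) ≡⟨ cong₂ _+_ (cong (recvOf x) (trans (cong (knowledgeAt κ) tx) knowledge≡Φ)) inFlight≡1+k ⟩
    recvOf x Φ + suc k                                 ∎))
    where open ≡-Reasoning

  kept∈ : ∀ {φ X} → φ ∈ knowledgeAt κ X → φ ∈ knowledgeᵐ (f X)
  kept∈ = kept∈-from (λ m → there (subst (_ ∈_) knowledge≡Φ m))

  transfer↑ : ∀ B' → ChainTransfer κ κ' B'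
  transfer↑ B' = record
    { keeps-unreleased = λ { {xi} u _ l → proj₁ u , λ { (here refl) → released-has-no-successor u l ; (there m) → proj₂ u m } }
    ; keeps-link = λ { _ _ (inj₁ m) → inj₁ (inj₁ (kept∈ m)) ; _ _ (inj₂ m) → inj₁ (inj₂ (∈-─⁺ (μ κ) p m (λ ()))) }
    ; keeps-head = λ _ h → kept∈ h }

  localChain↑ : ∀ w → LocalChain κ w → Unreleased? κ' w → LocalChain κ' w
  localChain↑ w c u = LocalChain-transfer w (transfer↑ (target w)) c u

  sent-consistent-here : Sent.Consistent (Released x ∷ Φ)
  sent-consistent-here =
    Sent.Consistent-∷ _ _ (λ ())
      (subst Sent.Consistent knowledge≡Φ (sent-consistent {B}))
  recv-consistent-here : Recv.Consistent (Released x ∷ Φ)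
  recv-consistent-here =
    Recv.Consistent-∷ _ _ (λ ())
      (subst Recv.Consistent knowledge≡Φ (recv-consistent {B}))

compaction-preserves : ∀ {κ Φ} x C → (eq : α κ C ≡ just (idle Φ)) → Released x ∈ Φ → Invariant κ
  → Invariant (record κ { α = upd (α κ) C (idle (discard (λ φ → isCrea x φ ∨ isRel x φ ∨ isRecvOf x φ) Φ)) })
compaction-preserves {κ} {Φ} x C eq rlm I = record
    { internal-used = λ i → internal-used (i← i)
    ; external-absent = λ m → nothing→ (external-absent m)
    ; external-used = external-used
    ; receptionist-internal = λ m → i→ (receptionist-internal m)
    ; fact-inUse = λ {X} m r → inUse↑ (fact-inUse (old∈ {X} m) r)
    ; msg-inUse = λ m r → inUse↑ (msg-inUse m r)
    ; created-inUse = created-inUse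
    ; released-created = λ m → proj₁ (released-created m) , i→ (proj₂ (released-created m))
    ; app-wf = app-wf
    ; info-wf = λ m → proj₁ (info-wf m) , i→ (proj₂ (info-wf m))
    ; release-wf = λ m → let (a , b , c) = release-wf m in a , i→ b , c
    ; activated-wf = λ {X} m → activated-wf {X} (old∈ {X} m)
    ; createdUsing-wf = λ {X} m → createdUsing-wf {X} (old∈ {X} m)
    ; released-recorded = λ {X} m → released-recorded {X} (old∈ {X} m)
    ; sent-consistent = λ {X} → all-knowledge Sent.Consistent sent-consistent-here sent-consistent {X}
    ; recv-consistent = λ {X} → all-knowledge Recv.Consistent recv-consistent-here recv-consistent {X}
    ; balanced = balanced′
    ; carried-once = carried-once′
    ; chain-unrooted = λ w u i nρ → localChain↑ w (chain-unrooted w u (i← i) nρ) u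
    ; chain-receptionist = λ m → let (w , a , b , c) = chain-receptionist m in w , a , b , localChain↑ w c (last-unreleased (proj₂ (proj₂ c)))
    ; chain-exported = λ m en zR i → map₁ (λ c → localChain↑ _ c (last-unreleased (proj₂ (proj₂ c)))) (chain-exported m (nothing← en) zR (i← i))
    }
  where
  open Invariant I
  P : Fact → Bool
  P φ = isCrea x φ ∨ isRel x φ ∨ isRecvOf x φ
  open Update κ C (idle (discard P Φ)) eq
  κ' : Config
  κ' = record κ { α = f }
  knowledge≡Φ : knowledgeAt κ C ≡ Φ
  knowledge≡Φ = knowledgeAt-≡ κ C eq
  x-released : x ∈ released κ
  x-released = released-recorded {C} (subst (_ ∈_) (sym knowledge≡Φ) rlm)
  inUse↑ : ∀ {r} → InUse κ r → InUse κ' r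
  inUse↑ (a , b , c) = a , b , λ i → c (i← i)
  old∈ : ∀ {X φ} → φ ∈ knowledgeᵐ (f X) → φ ∈ knowledgeAt κ X
  old∈ {X} m with ∈-updated⁻ {X} m
  ... | inj₂ (_ , m') = m'
  ... | inj₁ (refl , m') = subst (_ ∈_) (sym knowledge≡Φ) (∈-discard⁻ Φ m')
  kept∈ : ∀ {φ X} → P φ ≡ false → φ ∈ knowledgeAt κ X → φ ∈ knowledgeᵐ (f X)
  kept∈ pf = kept∈-from (λ m → ∈-discard⁺ Φ (subst (_ ∈_) knowledge≡Φ m) pf)

  recvOf-same : ∀ w → w ∉ released κ → ∀ X → recvOf w (knowledgeᵐ (f X)) ≡ recvOf w (knowledgeAt κ X)
  recvOf-same w nr =
    knowledge-agrees (recvOf w)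
      (trans (Recv.countOf-discard P w Φ (λ _ → ≢⇒==ᴿ≡false x w λ { refl → nr x-released })) (cong (recvOf w) (sym knowledge≡Φ)))
  sentOf-same : ∀ w X → sentOf w (knowledgeᵐ (f X)) ≡ sentOf w (knowledgeAt κ X)
  sentOf-same w = knowledge-agrees (sentOf w) (trans (Sent.countOf-discard P w Φ (λ _ → refl)) (cong (sentOf w) (sym knowledge≡Φ)))

  balanced′ : ∀ w → Internal κ' (owner w) → Internal κ' (target w) → w ∉ released κ' → Balance κ' w
  balanced′ w io it nrel with balanced w (i← io) (i← it) nrel
  ... | inj₁ (nr , e0) = inj₁ (nr , trans (sentOf-same w (owner w)) (trans e0 (cong (_+ inFlight w (μ κ)) (sym (recvOf-same w nrel (target w))))))
  ... | inj₂ (h , a , c , n0) =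
      inj₂ ( (λ D n m → trans (h D n m) (cong (_+ inFlight w (μ κ)) (sym (recvOf-same w nrel (target w)))))
           , (λ m → a (old∈ m))
           , (λ v m → c v (old∈ m))
           , n0
           )

  carried-once′ : ∀ w → Internal κ' (owner w) → CarriedOnce κ' w
  carried-once′ w io with carried-once w (i← io)
  ... | inj₁ z = inj₁ z
  ... | inj₂ (o , a , nr , nrel) = inj₂ (o , (λ m → a (old∈ m)) , nr , nrel)

  transfer↑ : ∀ B' → ChainTransfer κ κ' B'
  transfer↑ B' = record
    { keeps-unreleased = λ u _ _ → u
    ; keeps-link = λ { _ _ (inj₁ m) → inj₁ (inj₁ (kept∈ refl m)) ; _ _ (inj₂ m) → inj₁ (inj₂ m) }
    ; keeps-head = λ { {x₁} u h → kept∈ (keeps-Created u) h } }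
    where
    keeps-Created : ∀ {x₁} → Unreleased? κ x₁ → P (Created x₁) ≡ false
    keeps-Created {x₁} u rewrite ≢⇒==ᴿ≡false x x₁ (λ { refl → proj₂ u x-released }) = refl

  localChain↑ : ∀ w → LocalChain κ w → Unreleased? κ' w → LocalChain κ' w
  localChain↑ w c u = LocalChain-transfer w (transfer↑ (target w)) c u

  sent-consistent-here : Sent.Consistent (discard P Φ)
  sent-consistent-here =
    Sent.Consistent-discard P Φ (λ _ _ _ → refl)
      (subst Sent.Consistent knowledge≡Φ (sent-consistent {C}))
  recv-consistent-here : Recv.Consistent (discard P Φ)
  recv-consistent-here =
    Recv.Consistent-discard P Φ (λ _ _ _ → refl)
      (subst Recv.Consistent knowledge≡Φ (recv-consistent {C}))

sendInfo-preserves : ∀ {κ Φ} y z A → (eq : α κ A ≡ just (busy Φ)) → owner y ≡ A → CreatedUsing y z ∈ Φ → Invariant κ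
  → Invariant (record κ { α = upd (α κ) A (busy (IncSent y (discard (isCU y z) Φ))) ; μ = (target y , Info y z (owner z)) ∷ μ κ })
sendInfo-preserves {κ} {Φ} y z A eq oy cu I = record
    { internal-used = λ i → internal-used (i← i)
    ; external-absent = λ m → nothing→ (external-absent m)
    ; external-used = external-used
    ; receptionist-internal = λ m → i→ (receptionist-internal m)
    ; fact-inUse = λ {X} → fact-inUse′ {X}
    ; msg-inUse = msg-inUse′
    ; created-inUse = created-inUse
    ; released-created = λ m → proj₁ (released-created m) , i→ (proj₂ (released-created m))
    ; app-wf = λ { (here ()) ; (there m) → app-wf m }
    ; info-wf = λ { (here refl) → refl , i→ (subst (Internal κ) (sym oy) (_ , eq)) ; (there m) → proj₁ (info-wf m) , i→ (proj₂ (info-wf m)) }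
    ; release-wf = λ { (here ()) ; (there m) → let (a , b , c) = release-wf m in a , i→ b , c }
    ; activated-wf = λ {X} m → let (a , b , c , d) = activated-wf {X} (old∈ {X} (λ ()) m) in a , b , c , noRelease↑ d
    ; createdUsing-wf = λ {X} m → let (a , b) = createdUsing-wf {X} (old∈ {X} (λ ()) m) in a , noRelease↑ b
    ; released-recorded = λ {X} m → released-recorded {X} (old∈ {X} (λ ()) m)
    ; sent-consistent = λ {X} → all-knowledge Sent.Consistent sent-consistent-here sent-consistent {X}
    ; recv-consistent = λ {X} → all-knowledge Recv.Consistent recv-consistent-here recv-consistent {X}
    ; balanced = balanced′
    ; carried-once = carried-once′
    ; chain-unrooted = λ w u i nρ → localChain↑ w (chain-unrooted w u (i← i) nρ) u
    ; chain-receptionist = λ m → let (w , a , b , c) = chain-receptionist m in w , a , b , localChain↑ w c (last-unreleased (proj₂ (proj₂ c)))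
    ; chain-exported = λ { (here ()) ; (there m) en zR i → map₁ (λ c → localChain↑ _ c (last-unreleased (proj₂ (proj₂ c)))) (chain-exported m (nothing← en) zR (i← i)) }
    }
  where
  open Invariant I
  Φ'' : Knowledge
  Φ'' = discard (isCU y z) Φ
  open Update κ A (busy (IncSent y Φ'')) eq
  e : Address × Msg
  e = (target y , Info y z (owner z))
  κ' : Config
  κ' = record κ { α = f ; μ = e ∷ μ κ }
  knowledge≡Φ : knowledgeAt κ A ≡ Φ
  knowledge≡Φ = knowledgeAt-≡ κ A eq
  fromΦ : ∀ {φ} → φ ∈ Φ → φ ∈ knowledgeAt κ A
  fromΦ m = subst (_ ∈_) (sym knowledge≡Φ) m
  inUse↑ : ∀ {r} → InUse κ r → InUse κ' r
  inUse↑ (a , b , c) = a , b , λ i → c (i← i)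
  noRelease↑ : ∀ {w} → NoReleaseMsg κ w → NoReleaseMsg κ' w
  noRelease↑ h D n (here ())
  noRelease↑ h D n (there m) = h D n m

  fact-inUse′ : ∀ {X φ r} → φ ∈ knowledgeᵐ (f X) → r ∈ factRefobs φ → InUse κ' r
  fact-inUse′ {X} m r with ∈-updated⁻ {X} m
  ... | inj₂ (_ , m') = inUse↑ (fact-inUse m' r)
  fact-inUse′ {X} m (here refl) | inj₁ (refl , here refl) = inUse↑ (fact-inUse (fromΦ cu) (here refl))
  ... | inj₁ (refl , there d) = inUse↑ (fact-inUse (fromΦ (∈-discard⁻ Φ (∈-discard⁻ Φ'' d))) r)

  msg-inUse′ : ∀ {e' r} → e' ∈ μ κ' → r ∈ msgRefobs (proj₂ e') → InUse κ' r
  msg-inUse′ (here refl) (here refl) = inUse↑ (fact-inUse (fromΦ cu) (here refl))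
  msg-inUse′ (here refl) (there (here refl)) = inUse↑ (fact-inUse (fromΦ cu) (there (here refl)))
  msg-inUse′ (there m) r = inUse↑ (msg-inUse m r)

  old∈ : ∀ {X φ} → (∀ {w k} → φ ≢ SentCount w k) → φ ∈ knowledgeᵐ (f X) → φ ∈ knowledgeAt κ X
  old∈ {X} ns m with ∈-updated⁻ {X} m
  ... | inj₂ (_ , m') = m'
  ... | inj₁ (refl , here refl) = ⊥-elim (ns refl)
  ... | inj₁ (refl , there d) = fromΦ (∈-discard⁻ Φ (∈-discard⁻ Φ'' d))

  sentOf-same-≢ : ∀ w → w ≢ y → ∀ X → sentOf w (knowledgeᵐ (f X)) ≡ sentOf w (knowledgeAt κ X)
  sentOf-same-≢ w ne =
    knowledge-agrees (sentOf w)
      (trans (Sent.countOf-Inc-≢ w y Φ'' ne) (trans (Sent.countOf-discard (isCU y z) w Φ (λ _ → refl)) (cong (sentOf w) (sym knowledge≡Φ))))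
  sentOf-inc : sentOf y (knowledgeᵐ (f (owner y))) ≡ suc (sentOf y (knowledgeAt κ (owner y)))
  sentOf-inc rewrite oy | knowledge-here | knowledge≡Φ = trans (Sent.countOf-Inc y Φ'') (cong suc (Sent.countOf-discard (isCU y z) y Φ (λ _ → refl)))
  recvOf-same : ∀ w X → recvOf w (knowledgeᵐ (f X)) ≡ recvOf w (knowledgeAt κ X)
  recvOf-same w =
    knowledge-agrees (recvOf w)
      (trans (Recv.countOf-discard (isSentOf y) w Φ'' (λ _ → refl)) (trans (Recv.countOf-discard (isCU y z) w Φ (λ _ → refl)) (cong (recvOf w) (sym knowledge≡Φ))))

  balanced′ : ∀ w → Internal κ' (owner w) → Internal κ' (target w) → w ∉ released κ' → Balance κ' w
  balanced′ w io it nrel with balanced w (i← io) (i← it) nrel | w ≟ᴿ y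
  ... | inj₂ (h , a , c , n0) | yes refl = ⊥-elim (c z (subst (λ X → _ ∈ knowledgeAt κ X) (sym oy) (fromΦ cu)))
  ... | inj₁ (nr , e0) | yes refl = inj₁ (noRelease↑ nr , balance-eq)
    where
    balance-eq : sentOf y (knowledgeᵐ (f (owner y))) ≡ recvOf y (knowledgeᵐ (f (target y))) + inFlight y (e ∷ μ κ)
    balance-eq rewrite ==ᴿ-refl y = trans sentOf-inc (trans (cong suc e0) (trans (sym (+-suc _ _)) (cong (_+ suc (inFlight y (μ κ))) (sym (recvOf-same y (target y))))))
  ... | inj₁ (nr , e0) | no ne = inj₁ (noRelease↑ nr , balance-eq)
    where
    balance-eq : sentOf w (knowledgeᵐ (f (owner w))) ≡ recvOf w (knowledgeᵐ (f (target w))) + inFlight w (e ∷ μ κ)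
    balance-eq rewrite ≢⇒==ᴿ≡false w y ne = trans (sentOf-same-≢ w ne (owner w)) (trans e0 (cong (_+ inFlight w (μ κ)) (sym (recvOf-same w (target w)))))
  ... | inj₂ (h , a , c , n0) | no ne = inj₂ (release-count′ , (λ m → a (old∈ (λ ()) m)) , (λ v m → c v (old∈ (λ ()) m)) , n0)
    where
    release-count′ : ∀ D n → (D , Release w n) ∈ μ κ' → n ≡ recvOf w (knowledgeᵐ (f (target w))) + inFlight w (e ∷ μ κ)
    release-count′ D n (here ())
    release-count′ D n (there m) rewrite ≢⇒==ᴿ≡false w y ne = trans (h D n m) (cong (_+ inFlight w (μ κ)) (sym (recvOf-same w (target w))))

  carried-once′ : ∀ w → Internal κ' (owner w) → CarriedOnce κ' w
  carried-once′ w io with carried-once w (i← io)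
  ... | inj₁ z = inj₁ z
  ... | inj₂ (o , a , nr , nrel) = inj₂ (o , (λ m → a (old∈ (λ ()) m)) , noRelease↑ nr , nrel)

  kept∈ : ∀ {φ X} → isCU y z φ ≡ false → isSentOf y φ ≡ false → φ ∈ knowledgeAt κ X → φ ∈ knowledgeᵐ (f X)
  kept∈ p1 p2 = kept∈-from (λ m → there (∈-discard⁺ Φ'' (∈-discard⁺ Φ (subst (_ ∈_) knowledge≡Φ m) p1) p2))

  transfer↑ : ∀ B' → ChainTransfer κ κ' B'
  transfer↑ B' = record
    { keeps-unreleased = λ u _ _ → u
    ; keeps-link = keeps-link′
    ; keeps-head = λ _ h → kept∈ refl refl h }
    where
    keeps-link′ : ∀ {xi xj} → Unreleased? κ xi → target xi ≡ B' → LinkIn κ B' xi xj → LinkIn κ' B' xi xj ⊎ Created xj ∈ knowledgeᵐ (f B')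
    keeps-link′ _ _ (inj₂ m) = inj₁ (inj₂ (there m))
    keeps-link′ {xi} {xj} _ t (inj₁ m) with xi ≟ᴿ y | xj ≟ᴿ z
    ... | yes refl | yes refl = inj₁ (inj₂ (here (cong (λ X → X , Info y z (owner z)) (sym t))))
    ... | no n | _ = inj₁ (inj₁ (kept∈ pf refl m))
      where pf : isCU y z (CreatedUsing xi xj) ≡ false
            pf rewrite ≢⇒==ᴿ≡false y xi (λ e → n (sym e)) = refl
    ... | yes refl | no n = inj₁ (inj₁ (kept∈ pf refl m))
      where pf : isCU y z (CreatedUsing y xj) ≡ false
            pf rewrite ==ᴿ-refl y | ≢⇒==ᴿ≡false z xj (λ e → n (sym e)) = refl

  localChain↑ : ∀ w → LocalChain κ w → Unreleased? κ' w → LocalChain κ' w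
  localChain↑ w c u = LocalChain-transfer w (transfer↑ (target w)) c u

  sent-consistent-here : Sent.Consistent (IncSent y Φ'')
  sent-consistent-here =
    Sent.Consistent-Inc y Φ''
      (Sent.Consistent-discard (isCU y z) Φ (λ _ _ _ → refl)
        (subst Sent.Consistent knowledge≡Φ (sent-consistent {A})))
  recv-consistent-here : Recv.Consistent (IncSent y Φ'')
  recv-consistent-here =
    Recv.Consistent-∷ _ _ (λ ())
      (Recv.Consistent-discard (isSentOf y) Φ'' (λ _ _ _ → refl)
        (Recv.Consistent-discard (isCU y z) Φ (λ _ _ _ → refl)
          (subst Recv.Consistent knowledge≡Φ (recv-consistent {A}))))

sendRelease-preserves : ∀ {κ Φ} x A n → (eq : α κ A ≡ just (busy Φ)) → owner x ≡ A → Activated x ∈ Φ → Φ ⊢ SentCount x n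
  → (∀ y → CreatedUsing x y ∉ Φ) → Invariant κ
  → Invariant (record κ { α = upd (α κ) A (busy (discard (λ φ → isAct x φ ∨ isSentOf x φ) Φ)) ; μ = (target x , Release x n) ∷ μ κ })
sendRelease-preserves {κ} {Φ} x A n eq ox am d nocu I = record
    { internal-used = λ i → internal-used (i← i)
    ; external-absent = λ m → nothing→ (external-absent m)
    ; external-used = external-used
    ; receptionist-internal = λ m → i→ (receptionist-internal m)
    ; fact-inUse = λ {X} m r → inUse↑ (fact-inUse (old∈ {X} m) r)
    ; msg-inUse = msg-inUse′
    ; created-inUse = created-inUse
    ; released-created = λ m → proj₁ (released-created m) , i→ (proj₂ (released-created m))
    ; app-wf = λ { (here ()) ; (there m) → app-wf m }
    ; info-wf = λ { (here ()) ; (there m) → proj₁ (info-wf m) , i→ (proj₂ (info-wf m)) }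
    ; release-wf = λ { (here refl) → refl , i→ x-owner-internal , proj₁ (proj₂ (activated-wf {A} (fromΦ am))) ; (there m) → let (a , b , c) = release-wf m in a , i→ b , c }
    ; activated-wf = activated-wf′
    ; createdUsing-wf = createdUsing-wf′
    ; released-recorded = λ {X} m → released-recorded {X} (old∈ {X} m)
    ; sent-consistent = λ {X} → all-knowledge Sent.Consistent sent-consistent-here sent-consistent {X}
    ; recv-consistent = λ {X} → all-knowledge Recv.Consistent recv-consistent-here recv-consistent {X}
    ; balanced = balanced′
    ; carried-once = carried-once′
    ; chain-unrooted = λ w u i nρ → localChain↑ w (chain-unrooted w u (i← i) nρ) u
    ; chain-receptionist = λ m → let (w , a , b , c) = chain-receptionist m in w , a , b , localChain↑ w c (last-unreleased (proj₂ (proj₂ c)))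
    ; chain-exported = λ { (here ()) ; (there m) en zR i → map₁ (λ c → localChain↑ _ c (last-unreleased (proj₂ (proj₂ c)))) (chain-exported m (nothing← en) zR (i← i)) }
    }
  where
  open Invariant I
  P : Fact → Bool
  P φ = isAct x φ ∨ isSentOf x φ
  open Update κ A (busy (discard P Φ)) eq
  e : Address × Msg
  e = (target x , Release x n)
  κ' : Config
  κ' = record κ { α = f ; μ = e ∷ μ κ }
  knowledge≡Φ : knowledgeAt κ A ≡ Φ
  knowledge≡Φ = knowledgeAt-≡ κ A eq
  fromΦ : ∀ {φ} → φ ∈ Φ → φ ∈ knowledgeAt κ A
  fromΦ m = subst (_ ∈_) (sym knowledge≡Φ) m
  x-owner-internal : Internal κ (owner x)
  x-owner-internal = subst (Internal κ) (sym ox) (_ , eq)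
  inUse↑ : ∀ {r} → InUse κ r → InUse κ' r
  inUse↑ (a , b , c) = a , b , λ i → c (i← i)
  noRelease↑ : ∀ {w} → w ≢ x → NoReleaseMsg κ w → NoReleaseMsg κ' w
  noRelease↑ ne h D n (here refl) = ne refl
  noRelease↑ ne h D n (there m) = h D n m

  old∈ : ∀ {X φ} → φ ∈ knowledgeᵐ (f X) → φ ∈ knowledgeAt κ X
  old∈ {X} m with ∈-updated⁻ {X} m
  ... | inj₂ (_ , m') = m'
  ... | inj₁ (refl , m') = fromΦ (∈-discard⁻ Φ m')

  msg-inUse′ : ∀ {e' r} → e' ∈ μ κ' → r ∈ msgRefobs (proj₂ e') → InUse κ' r
  msg-inUse′ (here refl) (here refl) = inUse↑ (fact-inUse (fromΦ am) (here refl))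
  msg-inUse′ (there m) r = inUse↑ (msg-inUse m r)

  x-not-activated↑ : ∀ {X} → Activated x ∉ knowledgeᵐ (f X)
  x-not-activated↑ {X} m with ∈-updated⁻ {X} m
  ... | inj₁ (refl , m') = true≢false (trans (sym pt) (∈-discard⇒false {P} Φ m'))
    where pt : P (Activated x) ≡ true
          pt rewrite ==ᴿ-refl x = refl
  ... | inj₂ (n' , m') = n' (trans (sym (proj₁ (activated-wf m'))) ox)

  activated-wf′ : ∀ {X w} → Activated w ∈ knowledgeᵐ (f X) → owner w ≡ X × w ∈ created κ' × w ∉ released κ' × NoReleaseMsg κ' w
  activated-wf′ {X} {w} m with activated-wf {X} (old∈ {X} m)
  ... | a , b , c , h = a , b , c , noRelease↑ (λ { refl → x-not-activated↑ {X} m }) h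

  no-CreatedUsing-x : ∀ {v} → CreatedUsing x v ∉ knowledgeAt κ (owner x)
  no-CreatedUsing-x m = nocu _ (subst (_ ∈_) (trans (cong (knowledgeAt κ) ox) knowledge≡Φ) m)

  createdUsing-wf′ : ∀ {X u v} → CreatedUsing u v ∈ knowledgeᵐ (f X) → owner u ≡ X × NoReleaseMsg κ' u
  createdUsing-wf′ {X} m with createdUsing-wf {X} (old∈ {X} m)
  ... | o , h = o , noRelease↑ (λ { refl → no-CreatedUsing-x (subst (λ Y → _ ∈ knowledgeAt κ Y) (sym o) (old∈ {X} m)) }) h

  sentOf-same-≢ : ∀ w → w ≢ x → ∀ X → sentOf w (knowledgeᵐ (f X)) ≡ sentOf w (knowledgeAt κ X)
  sentOf-same-≢ w ne =
    knowledge-agrees (sentOf w)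
      (trans (Sent.countOf-discard P w Φ (λ _ → ≢⇒==ᴿ≡false x w (λ e → ne (sym e)))) (cong (sentOf w) (sym knowledge≡Φ)))
  recvOf-same : ∀ w X → recvOf w (knowledgeᵐ (f X)) ≡ recvOf w (knowledgeAt κ X)
  recvOf-same w = knowledge-agrees (recvOf w) (trans (Recv.countOf-discard P w Φ (λ _ → refl)) (cong (recvOf w) (sym knowledge≡Φ)))

  x-activated : Activated x ∈ knowledgeAt κ (owner x)
  x-activated = subst (λ Y → _ ∈ knowledgeAt κ Y) (sym ox) (fromΦ am)

  balanced′ : ∀ w → Internal κ' (owner w) → Internal κ' (target w) → w ∉ released κ' → Balance κ' w
  balanced′ w io it nrel with balanced w (i← io) (i← it) nrel | w ≟ᴿ x
  ... | inj₂ (h , a , c , n0) | yes refl = ⊥-elim (a x-activated)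
  ... | inj₁ (nr , e0) | yes refl = inj₂ (release-count′ , x-not-activated↑ {owner x} , (λ v m → no-CreatedUsing-x (old∈ m)) , x-not-carried)
    where
    release-count′ : ∀ D n' → (D , Release x n') ∈ μ κ' → n' ≡ recvOf x (knowledgeᵐ (f (target x))) + inFlight x (μ κ)
    release-count′ D n' (here refl) = trans (⊢SentCount⇒sentOf Φ (subst Sent.Consistent knowledge≡Φ (sent-consistent {A})) d)
                           (trans (cong (sentOf x) (sym (trans (cong (knowledgeAt κ) ox) knowledge≡Φ)))
                           (trans e0 (cong (_+ inFlight x (μ κ)) (sym (recvOf-same x (target x))))))
    release-count′ D n' (there m) = ⊥-elim (nr D n' m)
    x-not-carried : carriers x (μ κ) ≡ 0
    x-not-carried with carried-once x x-owner-internal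
    ... | inj₁ z = z
    ... | inj₂ (_ , a , _) = ⊥-elim (a x-activated)
  ... | inj₁ (nr , e0) | no ne =
      inj₁ ( noRelease↑ ne nr
           , trans (sentOf-same-≢ w ne (owner w)) (trans e0 (cong (_+ inFlight w (μ κ)) (sym (recvOf-same w (target w)))))
           )
  ... | inj₂ (h , a , c , n0) | no ne = inj₂ (release-count′ , (λ m → a (old∈ m)) , (λ v m → c v (old∈ m)) , n0)
    where
    release-count′ : ∀ D n' → (D , Release w n') ∈ μ κ' → n' ≡ recvOf w (knowledgeᵐ (f (target w))) + inFlight w (μ κ)
    release-count′ D n' (here refl) = ⊥-elim (ne refl)
    release-count′ D n' (there m) = trans (h D n' m) (cong (_+ inFlight w (μ κ)) (sym (recvOf-same w (target w))))

  carried-once′ : ∀ w → Internal κ' (owner w) → CarriedOnce κ' w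
  carried-once′ w io with carried-once w (i← io)
  ... | inj₁ z = inj₁ z
  ... | inj₂ (o , a , nr , nrel) = inj₂ (o , (λ m → a (old∈ m)) , noRelease↑ (λ { refl → a x-activated }) nr , nrel)

  kept∈ : ∀ {φ X} → P φ ≡ false → φ ∈ knowledgeAt κ X → φ ∈ knowledgeᵐ (f X)
  kept∈ pf = kept∈-from (λ m → ∈-discard⁺ Φ (subst (_ ∈_) knowledge≡Φ m) pf)

  transfer↑ : ∀ B' → ChainTransfer κ κ' B'
  transfer↑ B' = record
    { keeps-unreleased = λ u _ _ → u
    ; keeps-link = λ { _ _ (inj₁ m) → inj₁ (inj₁ (kept∈ refl m)) ; _ _ (inj₂ m) → inj₁ (inj₂ (there m)) }
    ; keeps-head = λ _ h → kept∈ refl h }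

  localChain↑ : ∀ w → LocalChain κ w → Unreleased? κ' w → LocalChain κ' w
  localChain↑ w c u = LocalChain-transfer w (transfer↑ (target w)) c u

  sent-consistent-here : Sent.Consistent (discard P Φ)
  sent-consistent-here =
    Sent.Consistent-discard P Φ (λ _ _ _ → refl)
      (subst Sent.Consistent knowledge≡Φ (sent-consistent {A}))
  recv-consistent-here : Recv.Consistent (discard P Φ)
  recv-consistent-here =
    Recv.Consistent-discard P Φ (λ _ _ _ → refl)
      (subst Recv.Consistent knowledge≡Φ (recv-consistent {A}))

module NotInUse (κ : Config) (I : Invariant κ) (w : Refob) (w-unused : ¬ InUse κ w) where
  open Invariant I

  sentOf≡0 : ∀ X → sentOf w (knowledgeAt κ X) ≡ 0
  sentOf≡0 X = Sent.countOf-∉ w (knowledgeAt κ X) (λ _ m → w-unused (fact-inUse {X} m (here refl)))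

  recvOf≡0 : ∀ X → recvOf w (knowledgeAt κ X) ≡ 0
  recvOf≡0 X = Recv.countOf-∉ w (knowledgeAt κ X) (λ _ m → w-unused (fact-inUse {X} m (here refl)))

  Activated∉ : ∀ X → Activated w ∉ knowledgeAt κ X
  Activated∉ X m = w-unused (fact-inUse {X} m (here refl))

  noReleaseMsg : NoReleaseMsg κ w
  noReleaseMsg _ _ m = w-unused (msg-inUse m (here refl))

  inFlight≡0 : inFlight w (μ κ) ≡ 0
  inFlight≡0 = count≡0 (sentAlong w) (μ κ) not-sentAlong
    where
    not-sentAlong : ∀ {e} → e ∈ μ κ → sentAlong w e ≡ false
    not-sentAlong {_ , App y _} m with w ≟ᴿ y
    ... | yes refl = ⊥-elim (w-unused (msg-inUse m (here refl)))
    ... | no w≢y = ≢⇒==ᴿ≡false w y w≢y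
    not-sentAlong {_ , Info y _ _} m with w ≟ᴿ y
    ... | yes refl = ⊥-elim (w-unused (msg-inUse m (here refl)))
    ... | no w≢y = ≢⇒==ᴿ≡false w y w≢y
    not-sentAlong {_ , Release _ _} _ = refl

  carriers≡0 : carriers w (μ κ) ≡ 0
  carriers≡0 = count≡0 (carries w) (μ κ) not-carried
    where
    not-carried : ∀ {e} → e ∈ μ κ → carries w e ≡ false
    not-carried {_ , App _ R} m = inR-false w R (λ w∈R → w-unused (msg-inUse m (there w∈R)))
    not-carried {_ , Info _ _ _} _ = refl
    not-carried {_ , Release _ _} _ = refl

  not-created : w ∉ created κ
  not-created m = let (a , b , c) = created-inUse m in w-unused (a , b , λ _ → c)

  not-released : w ∉ released κ
  not-released m = not-created (proj₁ (released-created m))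

send-preserves : ∀ {κ Φ} (x : Refob) (A : Address) (ps : List (Refob × Refob))
       → (eq : α κ A ≡ just (busy Φ)) → owner x ≡ A → Φ ⊢ Activated x
       → All (SendOK κ Φ A x) ps → Invariant κ
       → Invariant (record κ
           { α = upd (α κ) A (busy (IncSent x Φ ++ map CU ps))
           ; μ = (target x , App x (map proj₂ ps)) ∷ μ κ
           ; usedT = map (λ p → token (proj₂ p)) ps ++ usedT κ
           ; created = map proj₂ ps ++ created κ })
send-preserves {κ} {Φ} x A ps eq ox ax ok I = record
    { internal-used = λ i → internal-used (i← i)
    ; external-absent = λ m → nothing→ (external-absent m)
    ; external-used = external-used
    ; receptionist-internal = λ m → i→ (receptionist-internal m)
    ; fact-inUse = λ {X} → fact-inUse′ {X}
    ; msg-inUse = msg-inUse′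
    ; created-inUse = created-inUse′
    ; released-created = λ m → ∈-++⁺ʳ R (proj₁ (released-created m)) , i→ (proj₂ (released-created m))
    ; app-wf = λ { (here refl) → refl , (λ zR → owner-new zR , ∈-++⁺ˡ zR) ; (there m) → proj₁ (app-wf m) , (λ zR → proj₁ (proj₂ (app-wf m) zR) , ∈-++⁺ʳ R (proj₂ (proj₂ (app-wf m) zR))) }
    ; info-wf = λ { (here ()) ; (there m) → proj₁ (info-wf m) , i→ (proj₂ (info-wf m)) }
    ; release-wf = λ { (here ()) ; (there m) → let (a , b , c) = release-wf m in a , i→ b , ∈-++⁺ʳ R c }
    ; activated-wf = λ {X} m → let (a , b , c , d) = activated-wf {X} (old∈ {X} (λ ()) (λ ()) m) in a , ∈-++⁺ʳ R b , c , noRelease↑ d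
    ; createdUsing-wf = createdUsing-wf′
    ; released-recorded = λ {X} m → released-recorded {X} (old∈ {X} (λ ()) (λ ()) m)
    ; sent-consistent = λ {X} → all-knowledge Sent.Consistent sent-consistent-here sent-consistent {X}
    ; recv-consistent = λ {X} → all-knowledge Recv.Consistent recv-consistent-here recv-consistent {X}
    ; balanced = balanced′
    ; carried-once = carried-once′
    ; chain-unrooted = chain-unrooted′
    ; chain-receptionist = λ m → let (w , a , b , c) = chain-receptionist m in w , a , b , localChain↑ w c (unreleased↑ (last-unreleased (proj₂ (proj₂ c))))
    ; chain-exported = chain-exported′
    }
  where
  open Invariant I
  R : List Refob
  R = map proj₂ ps
  Φ' : Knowledge
  Φ' = IncSent x Φ ++ map CU ps
  open Update κ A (busy Φ') eq
  e : Address × Msg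
  e = (target x , App x R)
  κ' : Config
  κ' = record κ { α = f ; μ = e ∷ μ κ ; usedT = map (λ p → token (proj₂ p)) ps ++ usedT κ ; created = R ++ created κ }
  knowledge≡Φ : knowledgeAt κ A ≡ Φ
  knowledge≡Φ = knowledgeAt-≡ κ A eq
  fromΦ : ∀ {φ} → φ ∈ Φ → φ ∈ knowledgeAt κ A
  fromΦ m = subst (_ ∈_) (sym knowledge≡Φ) m
  inUse↑ : ∀ {r} → InUse κ r → InUse κ' r
  inUse↑ (a , b , c) = a , b , λ i → ∈-++⁺ʳ _ (c (i← i))
  noRelease↑ : ∀ {w} → NoReleaseMsg κ w → NoReleaseMsg κ' w
  noRelease↑ h D n (here ())
  noRelease↑ h D n (there m) = h D n m
  unreleased↑ : ∀ {w} → Unreleased? κ w → Unreleased? κ' w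
  unreleased↑ (c , u) = ∈-++⁺ʳ R c , u

  x-inUse : InUse κ x
  x-inUse = fact-inUse {A} (fromΦ (⊢Activated⇒∈ ax)) (here refl)

  pair-ok : ∀ {y z} → (y , z) ∈ ps → SendOK κ Φ A x (y , z)
  pair-ok pm = All.lookup ok pm
  pair-of : ∀ {z} → z ∈ R → Σ Refob λ y → (y , z) ∈ ps
  pair-of zR with ∈-map⁻ proj₂ zR
  ... | (y , z) , pm , refl = y , pm
  owner-new : ∀ {z} → z ∈ R → owner z ≡ target x
  owner-new zR = let (y , pm) = pair-of zR in proj₁ (proj₂ (proj₂ (pair-ok pm)))
  CU∈⇒pair : ∀ {u v} → CreatedUsing u v ∈ map CU ps → (u , v) ∈ ps
  CU∈⇒pair m with ∈-map⁻ CU m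
  ... | (u , v) , pm , refl = pm
  sent-activated : ∀ {y z} → (y , z) ∈ ps → Activated y ∈ knowledgeAt κ A
  sent-activated pm = fromΦ (⊢Activated⇒∈ (proj₁ (pair-ok pm)))
  new-token-used : ∀ {y z} → (y , z) ∈ ps → token z ∈ usedT κ'
  new-token-used pm = ∈-++⁺ˡ (∈-map⁺ (λ p → token (proj₂ p)) pm)
  new-inUse : ∀ {y z} → (y , z) ∈ ps → InUse κ' z
  new-inUse {y} {z} pm with pair-ok pm | fact-inUse {A} (sent-activated pm) (here refl)
  ... | _ , _ , oz , tz , _ | _ , ty , _ = subst (_∈ usedA κ) (sym oz) (proj₁ (proj₂ x-inUse))
                                            , subst (_∈ usedA κ) (sym tz) ty , λ _ → new-token-used pm
  new-token-fresh : ∀ {z} → z ∈ R → token z ∉ usedT κ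
  new-token-fresh zR = let (y , pm) = pair-of zR in proj₂ (proj₂ (proj₂ (proj₂ (pair-ok pm))))
  new-not-inUse : ∀ {z} → z ∈ R → Internal κ (owner z) → InUse κ z → ⊥
  new-not-inUse zR i (_ , _ , c) = new-token-fresh zR (c i)
  new-not-created : ∀ {z} → z ∈ R → z ∉ created κ
  new-not-created zR m = new-token-fresh zR (proj₂ (proj₂ (created-inUse m)))
  new-not-released : ∀ {z} → z ∈ R → z ∉ released κ
  new-not-released zR m = new-not-created zR (proj₁ (released-created m))

  fact-inUse′ : ∀ {X φ r} → φ ∈ knowledgeᵐ (f X) → r ∈ factRefobs φ → InUse κ' r
  fact-inUse′ {X} m r with ∈-updated⁻ {X} m
  ... | inj₂ (_ , m') = inUse↑ (fact-inUse m' r)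
  ... | inj₁ (refl , m') with ∈-++⁻ (IncSent x Φ) m'
  ... | inj₁ (here refl) with r
  ... | here refl = inUse↑ x-inUse
  fact-inUse′ {X} m r | inj₁ (refl , m') | inj₁ (there d) = inUse↑ (fact-inUse (fromΦ (∈-discard⁻ Φ d)) r)
  fact-inUse′ {X} m r | inj₁ (refl , m') | inj₂ d with ∈-map⁻ CU d
  ... | (u , v) , pm , refl with r
  ... | here refl = inUse↑ (fact-inUse {A} (sent-activated pm) (here refl))
  ... | there (here refl) = new-inUse pm

  msg-inUse′ : ∀ {e' r} → e' ∈ μ κ' → r ∈ msgRefobs (proj₂ e') → InUse κ' r
  msg-inUse′ (here refl) (here refl) = inUse↑ x-inUse
  msg-inUse′ (here refl) (there zR) = new-inUse (proj₂ (pair-of zR))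
  msg-inUse′ (there m) r = inUse↑ (msg-inUse m r)

  created-inUse′ : ∀ {r} → r ∈ created κ' → owner r ∈ usedA κ' × target r ∈ usedA κ' × token r ∈ usedT κ'
  created-inUse′ m with ∈-++⁻ R m
  ... | inj₁ zR = let (a , b , c) = new-inUse (proj₂ (pair-of zR)) in a , b , new-token-used (proj₂ (pair-of zR))
  ... | inj₂ m' = let (a , b , c) = created-inUse m' in a , b , ∈-++⁺ʳ _ c

  old∈ : ∀ {X φ} → (∀ {w k} → φ ≢ SentCount w k) → (∀ {u v} → φ ≢ CreatedUsing u v) → φ ∈ knowledgeᵐ (f X) → φ ∈ knowledgeAt κ X
  old∈ {X} ns nc m with ∈-updated⁻ {X} m
  ... | inj₂ (_ , m') = m'
  ... | inj₁ (refl , m') with ∈-++⁻ (IncSent x Φ) m'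
  ... | inj₁ (here refl) = ⊥-elim (ns refl)
  ... | inj₁ (there d) = fromΦ (∈-discard⁻ Φ d)
  ... | inj₂ d with ∈-map⁻ CU d
  ... | _ , _ , refl = ⊥-elim (nc refl)

  createdUsing-wf′ : ∀ {X u v} → CreatedUsing u v ∈ knowledgeᵐ (f X) → owner u ≡ X × NoReleaseMsg κ' u
  createdUsing-wf′ {X} m with ∈-updated⁻ {X} m
  ... | inj₂ (_ , m') = let (a , b) = createdUsing-wf {X} m' in a , noRelease↑ b
  ... | inj₁ (refl , m') with ∈-++⁻ (IncSent x Φ) m'
  ... | inj₁ (here ())
  ... | inj₁ (there d) = let (a , b) = createdUsing-wf {A} (fromΦ (∈-discard⁻ Φ d)) in a , noRelease↑ b
  ... | inj₂ d = proj₁ (proj₂ (pair-ok (CU∈⇒pair d))) , noRelease↑ (proj₂ (proj₂ (proj₂ (activated-wf {A} (sent-activated (CU∈⇒pair d))))))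

  sentOf-same-≢ : ∀ w → w ≢ x → ∀ X → sentOf w (knowledgeᵐ (f X)) ≡ sentOf w (knowledgeAt κ X)
  sentOf-same-≢ w ne =
    knowledge-agrees (sentOf w)
      (trans (Sent.countOf-++ w (IncSent x Φ) (map CU ps) (SentFree-CU ps)) (trans (Sent.countOf-Inc-≢ w x Φ ne) (cong (sentOf w) (sym knowledge≡Φ))))
  sentOf-inc : sentOf x (knowledgeᵐ (f (owner x))) ≡ suc (sentOf x (knowledgeAt κ (owner x)))
  sentOf-inc rewrite ox | knowledge-here | knowledge≡Φ = trans (Sent.countOf-++ x (IncSent x Φ) (map CU ps) (SentFree-CU ps)) (Sent.countOf-Inc x Φ)
  recvOf-same : ∀ w X → recvOf w (knowledgeᵐ (f X)) ≡ recvOf w (knowledgeAt κ X)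
  recvOf-same w =
    knowledge-agrees (recvOf w)
      (trans (Recv.countOf-++ w (IncSent x Φ) (map CU ps) (RecvFree-CU ps)) (trans (Recv.countOf-discard (isSentOf x) w Φ (λ _ → refl)) (cong (recvOf w) (sym knowledge≡Φ))))

  x-activated : Activated x ∈ knowledgeAt κ (owner x)
  x-activated = subst (λ Y → _ ∈ knowledgeAt κ Y) (sym ox) (fromΦ (⊢Activated⇒∈ ax))

  new≢x : ∀ {w} → w ∈ R → Internal κ (owner w) → w ≢ x
  new≢x wR i refl = new-not-inUse wR i x-inUse

  balanced′ : ∀ w → Internal κ' (owner w) → Internal κ' (target w) → w ∉ released κ' → Balance κ' w
  balanced′ w io it nrel with inR w R in eqR
  ... | true = inj₁ (noRelease↑ Unused.noReleaseMsg , balance-eq)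
    where
    wR : w ∈ R
    wR = inR-sound w R eqR
    module Unused = NotInUse κ I w (new-not-inUse wR (i← io))
    balance-eq : sentOf w (knowledgeᵐ (f (owner w))) ≡ recvOf w (knowledgeᵐ (f (target w))) + inFlight w (e ∷ μ κ)
    balance-eq rewrite ≢⇒==ᴿ≡false w x (new≢x wR (i← io)) = trans (sentOf-same-≢ w (new≢x wR (i← io)) (owner w)) (trans (Unused.sentOf≡0 (owner w))
             (sym (cong₂ _+_ (trans (recvOf-same w (target w)) (Unused.recvOf≡0 (target w))) Unused.inFlight≡0)))
  ... | false with balanced w (i← io) (i← it) nrel | w ≟ᴿ x
  ... | inj₂ (h , a , c , n0) | yes refl = ⊥-elim (a x-activated)
  ... | inj₁ (nr , e0) | yes refl = inj₁ (noRelease↑ nr , balance-eq)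
    where
    balance-eq : sentOf x (knowledgeᵐ (f (owner x))) ≡ recvOf x (knowledgeᵐ (f (target x))) + inFlight x (e ∷ μ κ)
    balance-eq rewrite ==ᴿ-refl x = trans sentOf-inc (trans (cong suc e0) (trans (sym (+-suc _ _)) (cong (_+ suc (inFlight x (μ κ))) (sym (recvOf-same x (target x))))))
  ... | inj₁ (nr , e0) | no ne = inj₁ (noRelease↑ nr , balance-eq)
    where
    balance-eq : sentOf w (knowledgeᵐ (f (owner w))) ≡ recvOf w (knowledgeᵐ (f (target w))) + inFlight w (e ∷ μ κ)
    balance-eq rewrite ≢⇒==ᴿ≡false w x ne = trans (sentOf-same-≢ w ne (owner w)) (trans e0 (cong (_+ inFlight w (μ κ)) (sym (recvOf-same w (target w)))))
  ... | inj₂ (h , a , c , n0) | no ne = inj₂ (release-count′ , (λ m → a (old∈ (λ ()) (λ ()) m)) , no-CreatedUsing′ , n0)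
    where
    release-count′ : ∀ D n → (D , Release w n) ∈ μ κ' → n ≡ recvOf w (knowledgeᵐ (f (target w))) + inFlight w (e ∷ μ κ)
    release-count′ D n (here ())
    release-count′ D n (there m) rewrite ≢⇒==ᴿ≡false w x ne = trans (h D n m) (cong (_+ inFlight w (μ κ)) (sym (recvOf-same w (target w))))
    no-CreatedUsing′ : ∀ v → CreatedUsing w v ∉ knowledgeᵐ (f (owner w))
    no-CreatedUsing′ v m with ∈-updated⁻ {owner w} m
    ... | inj₂ (_ , m') = c v m'
    ... | inj₁ (eo , m') with ∈-++⁻ (IncSent x Φ) m'
    ... | inj₁ (here ())
    ... | inj₁ (there d) = c v (subst (λ Y → _ ∈ knowledgeAt κ Y) (sym eo) (fromΦ (∈-discard⁻ Φ d)))
    ... | inj₂ d = a (subst (λ Y → _ ∈ knowledgeAt κ Y) (sym eo) (sent-activated (CU∈⇒pair d)))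

  carried-once′ : ∀ w → Internal κ' (owner w) → CarriedOnce κ' w
  carried-once′ w io with inR w R in eqR
  ... | true =
      inj₂ ( cong suc Unused.carriers≡0
           , (λ m → Unused.Activated∉ (owner w) (old∈ (λ ()) (λ ()) m))
           , noRelease↑ Unused.noReleaseMsg
           , Unused.not-released
           )
    where
    wR : w ∈ R
    wR = inR-sound w R eqR
    module Unused = NotInUse κ I w (new-not-inUse wR (i← io))
  ... | false with carried-once w (i← io)
  ... | inj₁ z = inj₁ z
  ... | inj₂ (o , a , nr , nrel) = inj₂ (o , (λ m → a (old∈ (λ ()) (λ ()) m)) , noRelease↑ nr , nrel)

  kept∈ : ∀ {φ X} → isSentOf x φ ≡ false → φ ∈ knowledgeAt κ X → φ ∈ knowledgeᵐ (f X)
  kept∈ pf = kept∈-from (λ m → ∈-++⁺ˡ (there (∈-discard⁺ Φ (subst (_ ∈_) knowledge≡Φ m) pf)))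

  transfer↑ : ∀ B' → ChainTransfer κ κ' B'
  transfer↑ B' = record
    { keeps-unreleased = λ u _ _ → unreleased↑ u
    ; keeps-link = λ { _ _ (inj₁ m) → inj₁ (inj₁ (kept∈ refl m)) ; _ _ (inj₂ m) → inj₁ (inj₂ (there m)) }
    ; keeps-head = λ _ h → kept∈ refl h }

  localChain↑ : ∀ w → LocalChain κ w → Unreleased? κ' w → LocalChain κ' w
  localChain↑ w c u = LocalChain-transfer w (transfer↑ (target w)) c u

  new-chain : ∀ {z} → z ∈ R → Internal κ (target z) → target z ∉ ρ κ → LocalChain κ' z
  new-chain {z} zR iz nρ with pair-of zR
  ... | y , pm with pair-ok pm | activated-wf {A} (sent-activated pm)
  ... | _ , oy , oz , tz , _ | _ , yc , yr , _ with localChain↑ y (chain-unrooted y (yc , yr) (subst (Internal κ) tz iz) (λ m → nρ (subst (_∈ ρ κ) (sym tz) m))) (unreleased↑ (yc , yr))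
  ... | y₁ , h , c = subst (λ T → Σ Refob λ y₁ → Created y₁ ∈ knowledgeᵐ (f T) × ChainFrom κ' T y₁ z) (sym tz)
                       (y₁ , h , ChainFrom-snoc c (inj₁ CreatedUsing-y-z) (∈-++⁺ˡ zR , new-not-released zR) tz)
    where
    CreatedUsing-y-z : CreatedUsing y z ∈ knowledgeᵐ (f (owner y))
    CreatedUsing-y-z = subst (λ Y → _ ∈ knowledgeᵐ (f Y)) (sym oy) (∈-here⁺ (∈-++⁺ʳ (IncSent x Φ) (∈-map⁺ CU pm)))

  chain-unrooted′ : ∀ w → Unreleased? κ' w → Internal κ' (target w) → target w ∉ ρ κ' → LocalChain κ' w
  chain-unrooted′ w (wc , wr) i nρ with ∈-++⁻ R wc
  ... | inj₁ wR = new-chain wR (i← i) nρ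
  ... | inj₂ wc' = localChain↑ w (chain-unrooted w (wc' , wr) (i← i) nρ) (wc , wr)

  chain-exported′ : ∀ {C x' R' z} → (C , App x' R') ∈ μ κ' → f C ≡ nothing → z ∈ R' → Internal κ' (target z) → LocalChain κ' z ⊎ target z ∈ ρ κ'
  chain-exported′ {z = z} (here refl) en zR i with target z ∈? ρ κ
  ... | yes r = inj₂ r
  ... | no nr = inj₁ (new-chain zR (i← i) nr)
  chain-exported′ (there m) en zR i =
    map₁ (λ c → localChain↑ _ c (unreleased↑ (last-unreleased (proj₂ (proj₂ c)))))
      (chain-exported m (nothing← en) zR (i← i))

  sent-consistent-here : Sent.Consistent Φ'
  sent-consistent-here =
    Sent.Consistent-++ (IncSent x Φ) (map CU ps) (SentFree-CU ps)
      (Sent.Consistent-Inc x Φ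
        (subst Sent.Consistent knowledge≡Φ (sent-consistent {A})))
  recv-consistent-here : Recv.Consistent Φ'
  recv-consistent-here =
    Recv.Consistent-++ (IncSent x Φ) (map CU ps) (RecvFree-CU ps)
      (Recv.Consistent-∷ _ _ (λ ())
        (Recv.Consistent-discard (isSentOf x) Φ (λ _ _ _ → refl)
          (subst Recv.Consistent knowledge≡Φ (recv-consistent {A}))))

is-nothing⇒≡nothing : ∀ {A : Set} (m : Maybe A) → T (is-nothing m) → m ≡ nothing
is-nothing⇒≡nothing nothing _ = refl

inEv-preserves : ∀ {κ} (x : Refob) (A : Address) (R : List Refob)
       → A ∈ ρ κ → target x ≡ A → owner x ∈ χ κ
       → All (InOK κ A) R → Invariant κ
       → Invariant (record κ
           { μ = (A , App x R) ∷ μ κ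
           ; χ = filterᵇ (λ B → is-nothing (α κ B)) (map target R) ++ χ κ
           ; usedT = map token R ++ usedT κ
           ; usedA = map target R ++ usedA κ
           ; created = R ++ created κ })
inEv-preserves {κ} x A R Aρ tx oxχ ok I = record
    { internal-used = λ i → ∈-++⁺ʳ _ (internal-used i)
    ; external-absent = external-absent′
    ; external-used = external-used′
    ; receptionist-internal = receptionist-internal
    ; fact-inUse = λ {X} m r → inUse↑ (fact-inUse {X} m r)
    ; msg-inUse = msg-inUse′
    ; created-inUse = created-inUse′
    ; released-created = λ m → ∈-++⁺ʳ R (proj₁ (released-created m)) , proj₂ (released-created m)
    ; app-wf = λ { (here refl) → tx , (λ zR → proj₁ (All.lookup ok zR) , ∈-++⁺ˡ zR) ; (there m) → proj₁ (app-wf m) , (λ zR → proj₁ (proj₂ (app-wf m) zR) , ∈-++⁺ʳ R (proj₂ (proj₂ (app-wf m) zR))) }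
    ; info-wf = λ { (here ()) ; (there m) → info-wf m }
    ; release-wf = λ { (here ()) ; (there m) → let (a , b , c) = release-wf m in a , b , ∈-++⁺ʳ R c }
    ; activated-wf = λ {X} m → let (a , b , c , d) = activated-wf {X} m in a , ∈-++⁺ʳ R b , c , noRelease↑ d
    ; createdUsing-wf = λ {X} m → let (a , b) = createdUsing-wf {X} m in a , noRelease↑ b
    ; released-recorded = released-recorded
    ; sent-consistent = sent-consistent
    ; recv-consistent = recv-consistent
    ; balanced = balanced′
    ; carried-once = carried-once′
    ; chain-unrooted = chain-unrooted′
    ; chain-receptionist = λ m → let (w , a , b , c) = chain-receptionist m in w , a , ∈-++⁺ʳ _ b , localChain↑ w c (unreleased↑ (last-unreleased (proj₂ (proj₂ c))))
    ; chain-exported = chain-exported′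
    }
  where
  open Invariant I
  new : List Address
  new = filterᵇ (λ B → is-nothing (α κ B)) (map target R)
  e : Address × Msg
  e = (A , App x R)
  κ' : Config
  κ' = record κ { μ = e ∷ μ κ ; χ = new ++ χ κ ; usedT = map token R ++ usedT κ ; usedA = map target R ++ usedA κ ; created = R ++ created κ }
  iA : Internal κ A
  iA = receptionist-internal Aρ
  inUse↑ : ∀ {r} → InUse κ r → InUse κ' r
  inUse↑ (a , b , c) = ∈-++⁺ʳ _ a , ∈-++⁺ʳ _ b , λ i → ∈-++⁺ʳ _ (c i)
  noRelease↑ : ∀ {w} → NoReleaseMsg κ w → NoReleaseMsg κ' w
  noRelease↑ h D n (here ())
  noRelease↑ h D n (there m) = h D n m
  unreleased↑ : ∀ {w} → Unreleased? κ w → Unreleased? κ' w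
  unreleased↑ (c , u) = ∈-++⁺ʳ R c , u
  external-absent′ : ∀ {B} → B ∈ new ++ χ κ → α κ B ≡ nothing
  external-absent′ m with ∈-++⁻ new m
  ... | inj₁ m' = is-nothing⇒≡nothing _ (proj₂ (∈-filter⁻ (λ B → T? (is-nothing (α κ B))) {xs = map target R} m'))
  ... | inj₂ m' = external-absent m'
  external-used′ : ∀ {B} → B ∈ new ++ χ κ → B ∈ usedA κ'
  external-used′ m with ∈-++⁻ new m
  ... | inj₁ m' = ∈-++⁺ˡ (proj₁ (∈-filter⁻ (λ B → T? (is-nothing (α κ B))) {xs = map target R} m'))
  ... | inj₂ m' = ∈-++⁺ʳ _ (external-used m')
  received-inUse : ∀ {r} → r ∈ R → InUse κ' r
  received-inUse rR = subst (_∈ usedA κ') (sym (proj₁ (All.lookup ok rR))) (∈-++⁺ʳ _ (internal-used iA)) , ∈-++⁺ˡ (∈-map⁺ target rR) , λ _ → ∈-++⁺ˡ (∈-map⁺ token rR)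
  msg-inUse′ : ∀ {e' r} → e' ∈ μ κ' → r ∈ msgRefobs (proj₂ e') → InUse κ' r
  msg-inUse′ (here refl) (here refl) = ∈-++⁺ʳ _ (external-used oxχ) , subst (_∈ usedA κ') (sym tx) (∈-++⁺ʳ _ (internal-used iA)) , λ i → ⊥-elim (external⇒¬internal {κ} (external-absent oxχ) i)
  msg-inUse′ (here refl) (there rR) = received-inUse rR
  msg-inUse′ (there m) r = inUse↑ (msg-inUse m r)
  created-inUse′ : ∀ {r} → r ∈ created κ' → owner r ∈ usedA κ' × target r ∈ usedA κ' × token r ∈ usedT κ'
  created-inUse′ m with ∈-++⁻ R m
  ... | inj₁ rR = let (a , b , c) = received-inUse rR in a , b , ∈-++⁺ˡ (∈-map⁺ token rR)
  ... | inj₂ m' = let (a , b , c) = created-inUse m' in ∈-++⁺ʳ _ a , ∈-++⁺ʳ _ b , ∈-++⁺ʳ _ c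

  received-not-inUse : ∀ {w} → w ∈ R → InUse κ w → ⊥
  received-not-inUse wR (_ , _ , c) = proj₁ (proj₂ (All.lookup ok wR)) (c (subst (Internal κ) (sym (proj₁ (All.lookup ok wR))) iA))

  ≢x : ∀ {w} → Internal κ (owner w) → w ≢ x
  ≢x i refl = external⇒¬internal {κ} (external-absent oxχ) i

  balanced′ : ∀ w → Internal κ' (owner w) → Internal κ' (target w) → w ∉ released κ' → Balance κ' w
  balanced′ w io it nrel with inR w R in eqR
  ... | true = inj₁ (noRelease↑ Unused.noReleaseMsg , balance-eq)
    where
    module Unused = NotInUse κ I w (received-not-inUse (inR-sound w R eqR))
    balance-eq : sentOf w (knowledgeAt κ (owner w)) ≡ recvOf w (knowledgeAt κ (target w)) + inFlight w (e ∷ μ κ)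
    balance-eq rewrite ≢⇒==ᴿ≡false w x (≢x io) = trans (Unused.sentOf≡0 (owner w)) (sym (cong₂ _+_ (Unused.recvOf≡0 (target w)) Unused.inFlight≡0))
  ... | false with balanced w io it nrel
  ... | inj₁ (nr , e0) = inj₁ (noRelease↑ nr , balance-eq)
    where
    balance-eq : sentOf w (knowledgeAt κ (owner w)) ≡ recvOf w (knowledgeAt κ (target w)) + inFlight w (e ∷ μ κ)
    balance-eq rewrite ≢⇒==ᴿ≡false w x (≢x io) = e0
  ... | inj₂ (h , a , c , n0) = inj₂ (release-count′ , a , c , n0)
    where
    release-count′ : ∀ D n → (D , Release w n) ∈ μ κ' → n ≡ recvOf w (knowledgeAt κ (target w)) + inFlight w (e ∷ μ κ)
    release-count′ D n (here ())
    release-count′ D n (there m) rewrite ≢⇒==ᴿ≡false w x (≢x io) = h D n m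

  carried-once′ : ∀ w → Internal κ' (owner w) → CarriedOnce κ' w
  carried-once′ w io with inR w R in eqR
  ... | true = inj₂ (cong suc Unused.carriers≡0 , Unused.Activated∉ (owner w) , noRelease↑ Unused.noReleaseMsg , Unused.not-released)
    where
    module Unused = NotInUse κ I w (received-not-inUse (inR-sound w R eqR))
  ... | false with carried-once w io
  ... | inj₁ z = inj₁ z
  ... | inj₂ (o , a , nr , nrel) = inj₂ (o , a , noRelease↑ nr , nrel)

  transfer↑ : ∀ B' → ChainTransfer κ κ' B'
  transfer↑ B' = record
    { keeps-unreleased = λ u _ _ → unreleased↑ u
    ; keeps-link = λ { _ _ (inj₁ m) → inj₁ (inj₁ m) ; _ _ (inj₂ m) → inj₁ (inj₂ (there m)) }
    ; keeps-head = λ _ h → h }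

  localChain↑ : ∀ w → LocalChain κ w → Unreleased? κ' w → LocalChain κ' w
  localChain↑ w c u = LocalChain-transfer w (transfer↑ (target w)) c u

  chain-unrooted′ : ∀ w → Unreleased? κ' w → Internal κ' (target w) → target w ∉ ρ κ' → LocalChain κ' w
  chain-unrooted′ w (wc , wr) i nρ with ∈-++⁻ R wc
  ... | inj₁ wR = ⊥-elim (nρ (proj₂ (proj₂ (All.lookup ok wR)) i))
  ... | inj₂ wc' = localChain↑ w (chain-unrooted w (wc' , wr) i nρ) (wc , wr)

  chain-exported′ : ∀ {C x' R' z} → (C , App x' R') ∈ μ κ' → α κ C ≡ nothing → z ∈ R' → Internal κ' (target z) → LocalChain κ' z ⊎ target z ∈ ρ κ'
  chain-exported′ (here refl) en zR i = ⊥-elim (external⇒¬internal {κ} en iA)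
  chain-exported′ (there m) en zR i = map₁ (λ c → localChain↑ _ c (unreleased↑ (last-unreleased (proj₂ (proj₂ c))))) (chain-exported m en zR i)

spawn-preserves : ∀ {κ Φ} (x A B y : ℕ) → (eq : α κ A ≡ just (busy Φ)) → B ∉ usedA κ → Invariant κ
        → Invariant (record κ
            { α = upd (upd (α κ) A (busy (Activated (refob x A B) ∷ Φ))) B
                    (busy (Created (refob x A B) ∷ Created (refob y B B) ∷ Activated (refob y B B) ∷ []))
            ; usedT = x ∷ y ∷ usedT κ
            ; usedA = B ∷ usedA κ
            ; created = refob x A B ∷ refob y B B ∷ created κ })
spawn-preserves {κ} {Φ} x A B y eq B-fresh I = record
    { internal-used = internal-used′
    ; external-absent = λ {X} m → trans (upd-≢ f B stB X (used⇒≢B (external-used m))) (nothing→ (external-absent m))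
    ; external-used = λ m → there (external-used m)
    ; receptionist-internal = λ m → i→' (receptionist-internal m)
    ; fact-inUse = λ {X} → fact-inUse′ {X}
    ; msg-inUse = λ m r → inUse↑ (msg-inUse m r)
    ; created-inUse = created-inUse′
    ; released-created = λ m → there (there (proj₁ (released-created m))) , i→' (proj₂ (released-created m))
    ; app-wf = λ m → proj₁ (app-wf m) , (λ zR → proj₁ (proj₂ (app-wf m) zR) , there (there (proj₂ (proj₂ (app-wf m) zR))))
    ; info-wf = λ m → proj₁ (info-wf m) , i→' (proj₂ (info-wf m))
    ; release-wf = λ m → let (a , b , c) = release-wf m in a , i→' b , there (there c)
    ; activated-wf = λ {X} → activated-wf′ {X}
    ; createdUsing-wf = λ {X} m → createdUsing-wf {X} (createdUsing-old {X} m)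
    ; released-recorded = λ {X} m → released-recorded {X} (released-old {X} m)
    ; sent-consistent = λ {X} → sent-consistent′ {X}
    ; recv-consistent = λ {X} → recv-consistent′ {X}
    ; balanced = balanced′
    ; carried-once = carried-once′
    ; chain-unrooted = chain-unrooted′
    ; chain-receptionist = λ m → let (w , a , b , c) = chain-receptionist m in w , a , b , localChain↑ w c (unreleased↑ (last-unreleased (proj₂ (proj₂ c))))
    ; chain-exported = chain-exported′
    }
  where
  open Invariant I
  rx ry : Refob
  rx = refob x A B
  ry = refob y B B
  ΦB : Knowledge
  ΦB = Created rx ∷ Created ry ∷ Activated ry ∷ []
  stB : AState
  stB = busy ΦB
  open Update κ A (busy (Activated rx ∷ Φ)) eq
  g : Address → Maybe AState
  g = upd f B stB
  κ' : Config
  κ' = record κ { α = g ; usedT = x ∷ y ∷ usedT κ ; usedA = B ∷ usedA κ ; created = rx ∷ ry ∷ created κ }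
  knowledge≡Φ : knowledgeAt κ A ≡ Φ
  knowledge≡Φ = knowledgeAt-≡ κ A eq
  fromΦ : ∀ {φ} → φ ∈ Φ → φ ∈ knowledgeAt κ A
  fromΦ m = subst (_ ∈_) (sym knowledge≡Φ) m
  used⇒≢B : ∀ {X} → X ∈ usedA κ → X ≢ B
  used⇒≢B m refl = B-fresh m
  iA : Internal κ A
  iA = _ , eq
  knowledgeB≡ΦB : knowledgeᵐ (g B) ≡ ΦB
  knowledgeB≡ΦB rewrite upd-≡ f B stB = refl
  knowledge-elsewhere′ : ∀ {X} → X ≢ B → knowledgeᵐ (g X) ≡ knowledgeᵐ (f X)
  knowledge-elsewhere′ {X} n rewrite upd-≢ f B stB X n = refl
  i→' : ∀ {X} → Internal κ X → Internal κ' X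
  i→' {X} i = proj₁ (i→ i) , trans (upd-≢ f B stB X (used⇒≢B (internal-used i))) (proj₂ (i→ i))
  i←' : ∀ {X} → Internal κ' X → X ≢ B → Internal κ X
  i←' {X} (s , e) n = i← (s , trans (sym (upd-≢ f B stB X n)) e)
  internal-used′ : ∀ {X} → Internal κ' X → X ∈ usedA κ'
  internal-used′ {X} i with X ≟ B
  ... | yes refl = here refl
  ... | no n = there (internal-used (i←' i n))
  inUse↑ : ∀ {r} → InUse κ r → InUse κ' r
  inUse↑ (a , b , c) = there a , there b , λ i → there (there (c (i←' i (used⇒≢B a))))
  unreleased↑ : ∀ {w} → Unreleased? κ w → Unreleased? κ' w
  unreleased↑ (c , u) = there (there c) , u
  ∈-spawned⁻ : ∀ {X φ} → φ ∈ knowledgeᵐ (g X) → (X ≡ B × φ ∈ ΦB) ⊎ (X ≡ A × φ ≡ Activated rx) ⊎ (X ≢ B × φ ∈ knowledgeAt κ X)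
  ∈-spawned⁻ {X} m with X ≟ B
  ... | yes refl = inj₁ (refl , subst (_ ∈_) knowledgeB≡ΦB m)
  ... | no n with ∈-updated⁻ {X} (subst (_ ∈_) (knowledge-elsewhere′ n) m)
  ... | inj₁ (refl , here e) = inj₂ (inj₁ (refl , e))
  ... | inj₁ (refl , there d) = inj₂ (inj₂ (n , fromΦ d))
  ... | inj₂ (_ , d) = inj₂ (inj₂ (n , d))
  kept∈ : ∀ {X φ} → φ ∈ knowledgeAt κ X → φ ∈ knowledgeᵐ (g X)
  kept∈ {X} m with X ≟ B
  ... | yes refl = ⊥-elim (used⇒≢B (internal-used (knowledgeAt-internal κ X m)) refl)
  ... | no n = subst (_ ∈_) (sym (knowledge-elsewhere′ n)) (kept∈-from (λ d → there (subst (_ ∈_) knowledge≡Φ d)) m)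
  touches-B⇒¬InUse : ∀ {w} → owner w ≡ B ⊎ target w ≡ B → InUse κ w → ⊥
  touches-B⇒¬InUse (inj₁ e) (a , _ , _) = B-fresh (subst (_∈ usedA κ) e a)
  touches-B⇒¬InUse (inj₂ e) (_ , b , _) = B-fresh (subst (_∈ usedA κ) e b)
  targets-B⇒¬released : ∀ {w} → target w ≡ B → w ∉ released κ
  targets-B⇒¬released t m = touches-B⇒¬InUse (inj₂ t) (let (a , b , c) = created-inUse (proj₁ (released-created m)) in a , b , λ _ → c)

  fact-inUse′ : ∀ {X φ r} → φ ∈ knowledgeᵐ (g X) → r ∈ factRefobs φ → InUse κ' r
  fact-inUse′ {X} m r with ∈-spawned⁻ {X} m
  ... | inj₂ (inj₂ (_ , d)) = inUse↑ (fact-inUse d r)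
  fact-inUse′ {X} m (here refl) | inj₂ (inj₁ (refl , refl)) = there (internal-used iA) , here refl , λ _ → here refl
  fact-inUse′ {X} m (here refl) | inj₁ (refl , here refl) = there (internal-used iA) , here refl , λ _ → here refl
  fact-inUse′ {X} m (here refl) | inj₁ (refl , there (here refl)) = here refl , here refl , λ _ → there (here refl)
  fact-inUse′ {X} m (here refl) | inj₁ (refl , there (there (here refl))) = here refl , here refl , λ _ → there (here refl)

  created-inUse′ : ∀ {r} → r ∈ created κ' → owner r ∈ usedA κ' × target r ∈ usedA κ' × token r ∈ usedT κ'
  created-inUse′ (here refl) = there (internal-used iA) , here refl , here refl
  created-inUse′ (there (here refl)) = here refl , here refl , there (here refl)
  created-inUse′ (there (there m)) = let (a , b , c) = created-inUse m in there a , there b , there (there c)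

  touches-B⇒noReleaseMsg : ∀ {w} → (owner w ≡ B ⊎ target w ≡ B) → NoReleaseMsg κ' w
  touches-B⇒noReleaseMsg t D n m = touches-B⇒¬InUse t (msg-inUse m (here refl))

  activated-wf′ : ∀ {X w} → Activated w ∈ knowledgeᵐ (g X) → owner w ≡ X × w ∈ created κ' × w ∉ released κ' × NoReleaseMsg κ' w
  activated-wf′ {X} m with ∈-spawned⁻ {X} m
  ... | inj₂ (inj₂ (_ , d)) = let (a , b , c , e) = activated-wf d in a , there (there b) , c , e
  ... | inj₂ (inj₁ (refl , refl)) = refl , here refl , targets-B⇒¬released refl , touches-B⇒noReleaseMsg (inj₂ refl)
  ... | inj₁ (refl , there (there (here refl))) = refl , there (here refl) , targets-B⇒¬released refl , touches-B⇒noReleaseMsg (inj₂ refl)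

  createdUsing-old : ∀ {X u v} → CreatedUsing u v ∈ knowledgeᵐ (g X) → CreatedUsing u v ∈ knowledgeAt κ X
  createdUsing-old {X} m with ∈-spawned⁻ {X} m
  ... | inj₂ (inj₂ (_ , d)) = d
  ... | inj₁ (refl , there (there (here ())))
  ... | inj₁ (refl , there (there (there ())))

  released-old : ∀ {X u} → Released u ∈ knowledgeᵐ (g X) → Released u ∈ knowledgeAt κ X
  released-old {X} m with ∈-spawned⁻ {X} m
  ... | inj₂ (inj₂ (_ , d)) = d
  ... | inj₁ (refl , there (there (here ())))
  ... | inj₁ (refl , there (there (there ())))

  sent-consistent′ : ∀ {X} → Sent.Consistent (knowledgeᵐ (g X))
  sent-consistent′ {X} with X ≟ B
  ... | yes refl = subst Sent.Consistent (sym knowledgeB≡ΦB) (λ { (there (there (here ()))) ; (there (there (there ()))) })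
  ... | no n =
    subst Sent.Consistent (sym (knowledge-elsewhere′ n))
      (all-knowledge Sent.Consistent (Sent.Consistent-∷ _ _ (λ ()) (subst Sent.Consistent knowledge≡Φ (sent-consistent {A}))) (λ {Y} → sent-consistent {Y}) {X})
  recv-consistent′ : ∀ {X} → Recv.Consistent (knowledgeᵐ (g X))
  recv-consistent′ {X} with X ≟ B
  ... | yes refl = subst Recv.Consistent (sym knowledgeB≡ΦB) (λ { (there (there (here ()))) ; (there (there (there ()))) })
  ... | no n =
    subst Recv.Consistent (sym (knowledge-elsewhere′ n))
      (all-knowledge Recv.Consistent (Recv.Consistent-∷ _ _ (λ ()) (subst Recv.Consistent knowledge≡Φ (recv-consistent {A}))) (λ {Y} → recv-consistent {Y}) {X})

  sentOf-same : ∀ w X → X ≢ B → sentOf w (knowledgeᵐ (g X)) ≡ sentOf w (knowledgeAt κ X)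
  sentOf-same w X n = trans (cong (sentOf w) (knowledge-elsewhere′ n)) (knowledge-agrees (sentOf w) (cong (sentOf w) (sym knowledge≡Φ)) X)
  recvOf-same : ∀ w X → X ≢ B → recvOf w (knowledgeᵐ (g X)) ≡ recvOf w (knowledgeAt κ X)
  recvOf-same w X n = trans (cong (recvOf w) (knowledge-elsewhere′ n)) (knowledge-agrees (recvOf w) (cong (recvOf w) (sym knowledge≡Φ)) X)
  sentOf-fresh : ∀ w X → (InUse κ w → ⊥) → sentOf w (knowledgeᵐ (g X)) ≡ 0
  sentOf-fresh w X nm with X ≟ B
  ... | yes refl rewrite knowledgeB≡ΦB = refl
  ... | no n = trans (sentOf-same w X n) (NotInUse.sentOf≡0 κ I w nm X)
  recvOf-fresh : ∀ w X → (InUse κ w → ⊥) → recvOf w (knowledgeᵐ (g X)) ≡ 0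
  recvOf-fresh w X nm with X ≟ B
  ... | yes refl rewrite knowledgeB≡ΦB = refl
  ... | no n = trans (recvOf-same w X n) (NotInUse.recvOf≡0 κ I w nm X)

  activated-old : ∀ {w X} → target w ≢ B → Activated w ∈ knowledgeᵐ (g X) → Activated w ∈ knowledgeAt κ X
  activated-old {w} {X} tn m with ∈-spawned⁻ {X} m
  ... | inj₂ (inj₂ (_ , d)) = d
  ... | inj₂ (inj₁ (refl , refl)) = ⊥-elim (tn refl)
  ... | inj₁ (refl , there (there (here refl))) = ⊥-elim (tn refl)

  balanced′ : ∀ w → Internal κ' (owner w) → Internal κ' (target w) → w ∉ released κ' → Balance κ' w
  balanced′ w io it nrel with owner w ≟ B | target w ≟ B
  ... | yes ob | _ =
      inj₁ ( touches-B⇒noReleaseMsg (inj₁ ob)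
           , trans (sentOf-fresh w (owner w) nm) (sym (cong₂ _+_ (recvOf-fresh w (target w) nm) (NotInUse.inFlight≡0 κ I w nm)))
           )
    where nm = touches-B⇒¬InUse (inj₁ ob)
  ... | no _ | yes tb =
      inj₁ ( touches-B⇒noReleaseMsg (inj₂ tb)
           , trans (sentOf-fresh w (owner w) nm) (sym (cong₂ _+_ (recvOf-fresh w (target w) nm) (NotInUse.inFlight≡0 κ I w nm)))
           )
    where nm = touches-B⇒¬InUse (inj₂ tb)
  ... | no on | no tn with balanced w (i←' io on) (i←' it tn) nrel
  ... | inj₁ (nr , e0) = inj₁ (nr , trans (sentOf-same w (owner w) on) (trans e0 (cong (_+ inFlight w (μ κ)) (sym (recvOf-same w (target w) tn)))))
  ... | inj₂ (h , a , c , n0) =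
      inj₂ ( (λ D n m → trans (h D n m) (cong (_+ inFlight w (μ κ)) (sym (recvOf-same w (target w) tn))))
           , (λ m → a (activated-old tn m))
           , (λ v m → c v (createdUsing-old m))
           , n0
           )

  carried-once′ : ∀ w → Internal κ' (owner w) → CarriedOnce κ' w
  carried-once′ w io with owner w ≟ B
  ... | yes ob = inj₁ (NotInUse.carriers≡0 κ I w (touches-B⇒¬InUse (inj₁ ob)))
  ... | no on with carried-once w (i←' io on)
  ... | inj₁ z = inj₁ z
  ... | inj₂ (o , a , nr , nrel) = inj₂ (o , not-activated′ , nr , nrel)
    where
    not-activated′ : Activated w ∉ knowledgeᵐ (g (owner w))
    not-activated′ m with target w ≟ B
    ... | no tn = a (activated-old tn m)
    ... | yes tb = 1+n≢0 (trans (sym o) (NotInUse.carriers≡0 κ I w (touches-B⇒¬InUse (inj₂ tb))))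

  transfer↑ : ∀ B' → ChainTransfer κ κ' B'
  transfer↑ B' = record
    { keeps-unreleased = λ u _ _ → unreleased↑ u
    ; keeps-link = λ { _ _ (inj₁ m) → inj₁ (inj₁ (kept∈ m)) ; _ _ (inj₂ m) → inj₁ (inj₂ m) }
    ; keeps-head = λ _ h → kept∈ h }

  localChain↑ : ∀ w → LocalChain κ w → Unreleased? κ' w → LocalChain κ' w
  localChain↑ w c u = LocalChain-transfer w (transfer↑ (target w)) c u

  chain-unrooted′ : ∀ w → Unreleased? κ' w → Internal κ' (target w) → target w ∉ ρ κ' → LocalChain κ' w
  chain-unrooted′ w (here refl , wr) i nρ = rx , subst (Created rx ∈_) (sym knowledgeB≡ΦB) (here refl) , last (here refl , wr) refl
  chain-unrooted′ w (there (here refl) , wr) i nρ = ry , subst (Created ry ∈_) (sym knowledgeB≡ΦB) (there (here refl)) , last (there (here refl) , wr) refl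
  chain-unrooted′ w (there (there wc) , wr) i nρ =
    localChain↑ w (chain-unrooted w (wc , wr) (i←' i (used⇒≢B (proj₁ (proj₂ (created-inUse wc))))) nρ)
      (there (there wc) , wr)

  chain-exported′ : ∀ {C x' R' z} → (C , App x' R') ∈ μ κ' → g C ≡ nothing → z ∈ R' → Internal κ' (target z) → LocalChain κ' z ⊎ target z ∈ ρ κ'
  chain-exported′ {C} {z = z} m en zR i =
    map₁ (λ c → localChain↑ _ c (unreleased↑ (last-unreleased (proj₂ (proj₂ c)))))
      (chain-exported m (nothing← en1) zR (i←' i tzB))
    where
    C≢B : C ≢ B
    C≢B refl = ⊥-elim (nothing≢just (sym (trans (sym (upd-≡ f B stB)) en)))
    en1 : f C ≡ nothing
    en1 = trans (sym (upd-≢ f B stB C C≢B)) en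
    tzB : target z ≢ B
    tzB = used⇒≢B (proj₁ (proj₂ (created-inUse (proj₂ (proj₂ (app-wf m) zR)))))

step-preserves : ∀ {κ κ'} → Invariant κ → κ ⟶ κ' → Invariant κ'
step-preserves I (spawn x A B y eq _ _ _ B∉) = spawn-preserves x A B y eq B∉ I
step-preserves I (send x A ps eq ox ax ok _) = send-preserves x A ps eq ox ax ok I
step-preserves I (receive x B R eq p) = receive-preserves x B R eq p I
step-preserves I (becomeIdle A eq) = becomeIdle-preserves A eq I
step-preserves I (sendInfo y z A eq oy _ cu) = sendInfo-preserves y z A eq oy cu I
step-preserves I (info y z B C eq p) = info-preserves y z B C eq p I
step-preserves I (sendRelease x A n eq ox ax d no-cu) = sendRelease-preserves x A n eq ox ax d no-cu I
step-preserves I (release x B n eq p d) = release-preserves x B n eq p d I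
step-preserves I (compaction x C eq _ _ rx) = compaction-preserves x C eq rx I
step-preserves I (snapshot _ _) = I
step-preserves I (inEv x A R Aρ tx ox ok _) = inEv-preserves x A R Aρ tx ox ok I
step-preserves I (outEv x B R Bχ p) = outEv-preserves x B R Bχ p I
step-preserves I (releaseOut x B n _ p) = releaseOut-preserves x B n p I
step-preserves I (infoOut y z B C Cχ p) = infoOut-preserves y z B C Cχ p I

reachable-preserves : ∀ {κ κ'} → Invariant κ → Reachable κ κ' → Invariant κ'
reachable-preserves I ε = I
reachable-preserves I (s ◅ r) = reachable-preserves (step-preserves I s) r

lemma5p2 : (A₀ E₀ x₀ y₀ : ℕ) → A₀ ≢ E₀ → x₀ ≢ y₀
    → (κ : Config) → Reachable (initial A₀ E₀ x₀ y₀) κ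
    → (B : Address) → Internal κ B
    → (¬ RootSet κ B → (x : Refob) → Unreleased? κ x → target x ≡ B → Chain κ x)
    × (RootSet κ B → Σ Refob (λ y → target y ≡ B × owner y ∈ χ κ × Chain κ y))
lemma5p2 A₀ E₀ x₀ y₀ A₀≢E₀ _ κ κ-reachable B B-internal = unrooted , rooted
  where
  open Invariant (reachable-preserves (Initial.initial-invariant A₀ E₀ x₀ y₀ A₀≢E₀) κ-reachable)

  unrooted : ¬ RootSet κ B → (x : Refob) → Unreleased? κ x → target x ≡ B → Chain κ x
  unrooted B∉root x x-unreleased refl =
    LocalChain⇒Chain κ x B-internal (chain-unrooted x x-unreleased B-internal (B∉root ∘ inj₁))

  ExternalChain : Set
  ExternalChain = Σ Refob (λ y → target y ≡ B × owner y ∈ χ κ × Chain κ y)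

  receptionist-chain : B ∈ ρ κ → ExternalChain
  receptionist-chain B∈ρ with chain-receptionist B∈ρ
  ... | y , refl , y-external , c = y , refl , y-external , LocalChain⇒Chain κ y B-internal c

  rooted : RootSet κ B → ExternalChain
  rooted (inj₁ B∈ρ) = receptionist-chain B∈ρ
  rooted (inj₂ (C , x , R , m , C∈χ , z , z∈R , refl)) with chain-exported m (external-absent C∈χ) z∈R B-internal
  ... | inj₁ c = z , refl , subst (_∈ χ κ) (sym (proj₁ (proj₂ (app-wf m) z∈R))) C∈χ , LocalChain⇒Chain κ z B-internal c
  ... | inj₂ B∈ρ = receptionist-chain B∈ρ
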